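{- Let $\mathcal{H}$ be a class of finite simple graphs such that $K_2\in\mathcal{H}$, $\mathcal{H}$ is closed under vertex deletion, and there is an integer $k\ge 2$ such that every connected graph $G\in\mathcal{H}$ satisfies at least one of: (I) $G$ has two pendant vertices $u,v$ with $N_G(u)=N_G(v)$; or (II) $G$ has two adjacent vertices $u,v$ with $d_G(u)+d_G(v)\le k$. Then every connected graph $G\in\mathcal{H}$ with an even number of vertices satisfies $\chi_{\operatorname{odd}}(G)\le k-1$.
   Context: A pendant vertex is a vertex of degree $1$. A graph is odd if every vertex has odd degree (the empty graph counts as odd). A $k$-odd colouring of $G$ is a partition of $V(G)$ into $k$ (possibly empty) parts each inducing an odd subgraph; $\chi_{\operatorname{odd}}(G)$ is the least such $k$. -}

module Defs where

open import Data.Nat using (ℕ; zero; suc; _+_; _≤_; _%_)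
open import Data.Bool using (Bool; true; false; if_then_else_)
open import Data.Fin using (Fin; zero; suc; punchIn)
open import Data.List using (List; map; allFin)
open import Data.Nat.ListAction using (sum)
open import Data.Product using (Σ; ∃; _×_; _,_)
open import Data.Sum using (_⊎_)
open import Relation.Binary.PropositionalEquality using (_≡_; refl)
open import Relation.Nullary using (¬_)
open import Function.Bundles using (Inverse; _↔_)
import Data.Fin as Fin
open import Relation.Nullary.Decidable using (isYes)

record Graph (n : ℕ) : Set where
  field
    adj : Fin n → Fin n → Bool
    adj-sym : ∀ u v → adj u v ≡ adj v u
    adj-irr : ∀ v → adj v v ≡ false
open Graph public

GraphClass : Set₁
GraphClass = (n : ℕ) → Graph n → Set

deg : ∀ {n} → Graph n → Fin n → ℕ
deg {n} G v = sum (map (λ u → if adj G v u then 1 else 0) (allFin n))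

degIn : ∀ {n} → Graph n → (Fin n → Bool) → Fin n → ℕ
degIn {n} G P v = sum (map (λ u → if adj G v u then (if P u then 1 else 0) else 0) (allFin n))

IsOddℕ : ℕ → Set
IsOddℕ m = m % 2 ≡ 1

pendant : ∀ {n} → Graph n → Fin n → Set
pendant G v = deg G v ≡ 1

SameNbhd : ∀ {n} → Graph n → Fin n → Fin n → Set
SameNbhd {n} G u v = ∀ (w : Fin n) → adj G u w ≡ adj G v w

data Reach {n} (G : Graph n) : Fin n → Fin n → Set where
  here : ∀ {u} → Reach G u u
  step : ∀ {u v w} → adj G u v ≡ true → Reach G v w → Reach G u w

Connected : ∀ {n} → Graph n → Set
Connected {n} G = (1 ≤ n) × (∀ u v → Reach G u v)

deleteVertex : ∀ {m} → Graph (suc m) → Fin (suc m) → Graph m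
deleteVertex G v = record
  { adj = λ i j → adj G (punchIn v i) (punchIn v j)
  ; adj-sym = λ i j → adj-sym G (punchIn v i) (punchIn v j)
  ; adj-irr = λ i → adj-irr G (punchIn v i)
  }

Isomorphic : ∀ {n} → Graph n → Graph n → Set
Isomorphic {n} G G' =
  Σ (Fin n ↔ Fin n) λ π → ∀ u v → adj G u v ≡ adj G' (Inverse.to π u) (Inverse.to π v)

K2 : Graph 2
K2 = record { adj = k ; adj-sym = ks ; adj-irr = ki }
  where
  k : Fin 2 → Fin 2 → Bool
  k zero zero = false
  k zero (suc zero) = true
  k (suc zero) zero = true
  k (suc zero) (suc zero) = false
  ks : ∀ u v → k u v ≡ k v u
  ks zero zero = refl
  ks zero (suc zero) = refl
  ks (suc zero) zero = refl
  ks (suc zero) (suc zero) = refl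
  ki : ∀ v → k v v ≡ false
  ki zero = refl
  ki (suc zero) = refl

-- odd subgraph induced by each colour class of c : Fin n → Fin k,
-- i.e. every vertex has an odd number of neighbours of its own colour
IsOddColouring : ∀ {n} (G : Graph n) (k : ℕ) → (Fin n → Fin k) → Set
IsOddColouring {n} G k c =
  ∀ (v : Fin n) → IsOddℕ (degIn G (λ u → isYes (c u Fin.≟ c v)) v)

-- χ_odd(G) ≤ k  (parts may be empty, so this is existence of a k-odd colouring)
χodd≤ : ∀ {n} → Graph n → ℕ → Set
χodd≤ {n} G k = Σ (Fin n → Fin k) λ c → IsOddColouring G k c

{-# OPTIONS --safe #-}
module Submission where

-- Strong induction over connected vertex sets S of even size; closure under vertex deletion puts
-- every induced subgraph G[S] in H, so the hypothesis applies to it.  Pendant twins u, v with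
-- common neighbour w are deleted and then coloured like w, which changes the parity at w by two.
-- Otherwise let uv be an edge with d(u) + d(v) ≤ k and split S into two even connected parts that
-- meet only through u or v: S − C and C for an even component C of G[S] − u − v or, when all
-- components are odd, u and v each with a share of the components.  Odd colourings of the two
-- parts are merged after permuting the colours of one of them; as d(u) + d(v) ≤ k, a permutation
-- of the k − 1 colours can make every edge between the parts bichromatic.  If the odd components
-- cannot be shared so that both parts are even, uv is a bridge between two odd sides; each side is
-- coloured oddly except at its end of uv, where the degree is even, and giving u and v the same
-- colour makes both odd.

open import Defs
open import Data.Bool using (Bool; true; false; if_then_else_; not; _∧_; _∨_; _xor_)
open import Data.Bool.Properties using (∨-zeroʳ; ∧-identityʳ; not-involutive)
open import Data.Empty using (⊥; ⊥-elim)
open import Data.Fin using (Fin; zero; suc; punchIn; punchOut)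
open import Data.Fin.Permutation.Components using (transpose; transpose-inverse)
open import Data.Fin.Properties using (_≟_; 0≢1+n; suc-injective; punchIn-injective; punchIn-punchOut)
open import Data.List using (map; allFin; tabulate)
open import Data.List.Properties using (map-tabulate; map-cong)
open import Data.Nat using (ℕ; zero; suc; _+_; _≤_; _<_; _∸_; _%_; z≤n; s≤s)
open import Data.Nat.DivMod using ([m+n]%n≡m%n)
open import Data.Nat.Induction using (<-wellFounded)
open import Data.Nat.ListAction using (sum)
open import Data.Nat.Properties
  using (≤-refl; ≤-reflexive; ≤-trans; ≤-pred; <⇒≱; m≤m+n; m≤n+m; +-comm; +-assoc; +-suc; +-identityʳ;
         +-mono-≤; +-monoˡ-≤; +-monoʳ-≤; +-mono-≤-<; +-commutativeSemigroup)
open import Algebra.Properties.CommutativeSemigroup +-commutativeSemigroup using (interchange; x∙yz≈y∙xz)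
open import Data.Product using (Σ; _×_; _,_; proj₁; proj₂; map₂)
open import Data.Sum using (_⊎_; inj₁; inj₂; swap)
open import Function using (_∘_; id; case_of_)
open import Function.Construct.Identity using (↔-id)
open import Function.Definitions using (Injective)
open import Induction.WellFounded using (module All)
open import Relation.Binary.PropositionalEquality
import Relation.Binary.Construct.On as On
open import Relation.Nullary using (¬_; yes; no)
open import Relation.Nullary.Decidable using (isYes; dec-true; dec-false)

𝟙 : Bool → ℕ
𝟙 b = if b then 1 else 0

isOdd : ℕ → Bool
isOdd zero = false
isOdd (suc n) = not (isOdd n)

-- Records rather than bare equations, so that n can be inferred from a proof.
record Odd (n : ℕ) : Set where
  constructor odd
  field isOdd≡true : isOdd n ≡ true

record Even (n : ℕ) : Set where
  constructor even
  field isOdd≡false : isOdd n ≡ false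

isOdd-+ : ∀ m n → isOdd (m + n) ≡ isOdd m xor isOdd n
isOdd-+ zero n = refl
isOdd-+ (suc m) n rewrite isOdd-+ m n with isOdd m | isOdd n
... | true | true = refl
... | true | false = refl
... | false | _ = refl

odd+0 : ∀ {n} → Odd n → Odd (n + 0)
odd+0 {n} p rewrite +-identityʳ n = p

even+1 : ∀ {n} → Even n → Odd (n + 1)
even+1 {n} (even p) = odd (trans (isOdd-+ n 1) (cong (_xor true) p))

odd+even : ∀ {m n} → Odd m → Even n → Odd (m + n)
odd+even {m} {n} (odd p) (even q) = odd (trans (isOdd-+ m n) (cong₂ _xor_ p q))

odd+odd : ∀ {m n} → Odd m → Odd n → Even (m + n)
odd+odd {m} {n} (odd p) (odd q) = even (trans (isOdd-+ m n) (cong₂ _xor_ p q))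

even⇒0⊎≥2 : ∀ {n} → Even n → n ≡ 0 ⊎ 2 ≤ n
even⇒0⊎≥2 {zero} _ = inj₁ refl
even⇒0⊎≥2 {suc zero} (even ())
even⇒0⊎≥2 {suc (suc n)} _ = inj₂ (s≤s (s≤s z≤n))

%2≡𝟙isOdd : ∀ n → n % 2 ≡ 𝟙 (isOdd n)
%2≡𝟙isOdd zero = refl
%2≡𝟙isOdd (suc zero) = refl
%2≡𝟙isOdd (suc (suc n)) = begin
  (2 + n) % 2        ≡⟨ cong (_% 2) (+-comm 2 n) ⟩
  (n + 2) % 2        ≡⟨ [m+n]%n≡m%n n 2 ⟩
  n % 2              ≡⟨ %2≡𝟙isOdd n ⟩
  𝟙 (isOdd n)        ≡⟨ cong 𝟙 (sym (not-involutive (isOdd n))) ⟩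
  𝟙 (isOdd (2 + n))  ∎
  where open ≡-Reasoning

%2≡0⇒even : ∀ n → n % 2 ≡ 0 → Even n
%2≡0⇒even n eq with isOdd n in p | trans (sym (%2≡𝟙isOdd n)) eq
... | false | _ = even p

odd⇒%2≡1 : ∀ {n} → Odd n → n % 2 ≡ 1
odd⇒%2≡1 {n} (odd p) = trans (%2≡𝟙isOdd n) (cong 𝟙 p)

drop-positive-ends : ∀ {a b c k} → 1 ≤ a → 1 ≤ c → a + b + c ≤ suc k → b < k
drop-positive-ends {a} {b} {c} {k} a≥1 c≥1 le =
  subst (_≤ k) (+-comm b 1) (≤-pred (≤-trans (+-mono-≤ (+-monoˡ-≤ b a≥1) c≥1) le))

drop-positive-heads : ∀ {p a q b k} → 1 ≤ p → 1 ≤ q → (p + a) + (q + b) ≤ suc k → a + b < k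
drop-positive-heads {p} {a} {q} {b} {k} p≥1 q≥1 le =
  ≤-pred (subst (_≤ suc k) (cong suc (+-suc a b)) (≤-trans (+-mono-≤ (+-monoˡ-≤ a p≥1) (+-monoˡ-≤ b q≥1)) le))

_==_ : ∀ {n} → Fin n → Fin n → Bool
x == y = isYes (x ≟ y)

==-refl : ∀ {n} (x : Fin n) → (x == x) ≡ true
==-refl x with x ≟ x
... | yes _ = refl
... | no x≢x = ⊥-elim (x≢x refl)

==⇒≡ : ∀ {n} {x y : Fin n} → (x == y) ≡ true → x ≡ y
==⇒≡ {x = x} {y} p with x ≟ y
... | yes x≡y = x≡y

≢⇒==-false : ∀ {n} {x y : Fin n} → ¬ x ≡ y → (x == y) ≡ false
≢⇒==-false {x = x} {y} x≢y with x ≟ y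
... | yes x≡y = ⊥-elim (x≢y x≡y)
... | no _ = refl

==-injective : ∀ {n m} {π : Fin n → Fin m} → Injective _≡_ _≡_ π → ∀ a b → (π a == π b) ≡ (a == b)
==-injective π-inj a b with a ≟ b
... | yes refl = ==-refl _
... | no a≢b = ≢⇒==-false (a≢b ∘ π-inj)

Subset : ℕ → Set
Subset n = Fin n → Bool

module _ {n : ℕ} where

  infix 4 _∈_ _∉_ _⊆_
  infixr 7 _∩_
  infixr 6 _∪_ _─_
  infixr 5 _◃_

  -- A record rather than X x ≡ true, so that x and X can be inferred from a membership proof.
  record _∈_ (x : Fin n) (X : Subset n) : Set where
    constructor ∈⟨_⟩
    field true-at : X x ≡ true
  open _∈_ public

  _∉_ : Fin n → Subset n → Set
  x ∉ X = ¬ x ∈ X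

  _⊆_ : Subset n → Subset n → Set
  X ⊆ Y = ∀ {x} → x ∈ X → x ∈ Y

  ⁅_⁆ : Fin n → Subset n
  ⁅ x ⁆ y = y == x

  _∪_ _∩_ _─_ : Subset n → Subset n → Subset n
  (X ∪ Y) x = X x ∨ Y x
  (X ∩ Y) x = X x ∧ Y x
  (X ─ Y) x = X x ∧ not (Y x)

  _◃_ : Fin n → Subset n → Subset n
  x ◃ X = ⁅ x ⁆ ∪ X

  ∉⇒false : ∀ {x X} → x ∉ X → X x ≡ false
  ∉⇒false {x} {X} x∉X with X x in eq
  ... | true = ⊥-elim (x∉X ∈⟨ eq ⟩)
  ... | false = refl

  false⇒∉ : ∀ {x X} → X x ≡ false → x ∉ X
  false⇒∉ eq ∈⟨ p ⟩ with () ← trans (sym p) eq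

  ∈⁅⁆ : ∀ x → x ∈ ⁅ x ⁆
  ∈⁅⁆ x = ∈⟨ ==-refl x ⟩

  ∈⁅⁆⇒≡ : ∀ {x y} → x ∈ ⁅ y ⁆ → x ≡ y
  ∈⁅⁆⇒≡ ∈⟨ p ⟩ = ==⇒≡ p

  ∪⁺ˡ : ∀ {x X} Y → x ∈ X → x ∈ X ∪ Y
  ∪⁺ˡ {x} Y ∈⟨ p ⟩ = ∈⟨ cong (_∨ Y x) p ⟩

  ∪⁺ʳ : ∀ {x} X {Y} → x ∈ Y → x ∈ X ∪ Y
  ∪⁺ʳ {x} X ∈⟨ p ⟩ = ∈⟨ trans (cong (X x ∨_) p) (∨-zeroʳ (X x)) ⟩

  ∪⁻ : ∀ {x} X Y → x ∈ X ∪ Y → x ∈ X ⊎ x ∈ Y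
  ∪⁻ {x} X Y ∈⟨ p ⟩ with X x in eq | p
  ... | true | _ = inj₁ ∈⟨ eq ⟩
  ... | false | q = inj₂ ∈⟨ q ⟩

  ∩⁺ : ∀ {x X Y} → x ∈ X → x ∈ Y → x ∈ X ∩ Y
  ∩⁺ ∈⟨ p ⟩ ∈⟨ q ⟩ = ∈⟨ cong₂ _∧_ p q ⟩

  ∩⁻ˡ : ∀ {x} X Y → x ∈ X ∩ Y → x ∈ X
  ∩⁻ˡ {x} X Y ∈⟨ p ⟩ with X x in eq | p
  ... | true | _ = ∈⟨ eq ⟩

  ∩⁻ʳ : ∀ {x} X Y → x ∈ X ∩ Y → x ∈ Y
  ∩⁻ʳ {x} X Y ∈⟨ p ⟩ with X x | p
  ... | true | q = ∈⟨ q ⟩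

  ─⁺ : ∀ {x X Y} → x ∈ X → x ∉ Y → x ∈ X ─ Y
  ─⁺ ∈⟨ p ⟩ x∉Y = ∈⟨ cong₂ (λ a b → a ∧ not b) p (∉⇒false x∉Y) ⟩

  ─⁻ˡ : ∀ {x} X Y → x ∈ X ─ Y → x ∈ X
  ─⁻ˡ X Y = ∩⁻ˡ X (not ∘ Y)

  ─⁻ʳ : ∀ {x} X Y → x ∈ X ─ Y → x ∉ Y
  ─⁻ʳ {x} X Y x∈X─Y with Y x in eq | true-at (∩⁻ʳ X (not ∘ Y) x∈X─Y)
  ... | false | _ = false⇒∉ eq

  ◃-here : ∀ x X → x ∈ x ◃ X
  ◃-here x X = ∪⁺ˡ X (∈⁅⁆ x)

  ◃-there : ∀ x {X y} → y ∈ X → y ∈ x ◃ X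
  ◃-there x = ∪⁺ʳ ⁅ x ⁆

  ◃⁻ : ∀ {y x} X → y ∈ x ◃ X → y ≡ x ⊎ y ∈ X
  ◃⁻ {y} {x} X p with ∪⁻ ⁅ x ⁆ X p
  ... | inj₁ y∈⁅x⁆ = inj₁ (∈⁅⁆⇒≡ y∈⁅x⁆)
  ... | inj₂ y∈X = inj₂ y∈X

  record _≐_⊔_ (S X Y : Subset n) : Set where
    field
      ⊆ˡ : X ⊆ S
      ⊆ʳ : Y ⊆ S
      cover : ∀ {x} → x ∈ S → x ∈ X ⊎ x ∈ Y
      disjoint : ∀ {x} → x ∈ X → x ∈ Y → ⊥

  ⊔-swap : ∀ {S X Y} → S ≐ X ⊔ Y → S ≐ Y ⊔ X
  ⊔-swap p = record
    { ⊆ˡ = ⊆ʳ ; ⊆ʳ = ⊆ˡ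
    ; cover = λ x∈S → swap (cover x∈S)
    ; disjoint = λ x∈Y x∈X → disjoint x∈X x∈Y }
    where open _≐_⊔_ p

  ─-partition : ∀ {X Y} → Y ⊆ X → X ≐ (X ─ Y) ⊔ Y
  ─-partition {X} {Y} Y⊆X = record
    { ⊆ˡ = ─⁻ˡ X Y
    ; ⊆ʳ = Y⊆X
    ; cover = cover
    ; disjoint = λ p → ─⁻ʳ X Y p }
    where
    cover : ∀ {x} → x ∈ X → x ∈ X ─ Y ⊎ x ∈ Y
    cover {x} x∈X with Y x in eq
    ... | true = inj₂ ∈⟨ eq ⟩
    ... | false = inj₁ (─⁺ x∈X (false⇒∉ eq))

  ∪-partition : ∀ {X Y} → (∀ {x} → x ∈ X → x ∈ Y → ⊥) → (X ∪ Y) ≐ X ⊔ Y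
  ∪-partition {X} {Y} disjoint = record
    { ⊆ˡ = ∪⁺ˡ Y
    ; ⊆ʳ = ∪⁺ʳ X
    ; cover = ∪⁻ X Y
    ; disjoint = disjoint }

  ◃-partition : ∀ {x X} → x ∉ X → (x ◃ X) ≐ ⁅ x ⁆ ⊔ X
  ◃-partition {x} {X} x∉X = ∪-partition λ y∈⁅x⁆ y∈X → x∉X (subst (_∈ X) (∈⁅⁆⇒≡ y∈⁅x⁆) y∈X)

  ∩-partition : ∀ {S X Y} Z → S ≐ X ⊔ Y → (S ∩ Z) ≐ (X ∩ Z) ⊔ (Y ∩ Z)
  ∩-partition {S} {X} {Y} Z p = record
    { ⊆ˡ = λ q → ∩⁺ (⊆ˡ (∩⁻ˡ X Z q)) (∩⁻ʳ X Z q)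
    ; ⊆ʳ = λ q → ∩⁺ (⊆ʳ (∩⁻ˡ Y Z q)) (∩⁻ʳ Y Z q)
    ; cover = cover′
    ; disjoint = λ q r → disjoint (∩⁻ˡ X Z q) (∩⁻ˡ Y Z r) }
    where
    open _≐_⊔_ p
    cover′ : ∀ {x} → x ∈ S ∩ Z → x ∈ X ∩ Z ⊎ x ∈ Y ∩ Z
    cover′ q with cover (∩⁻ˡ S Z q)
    ... | inj₁ x∈X = inj₁ (∩⁺ x∈X (∩⁻ʳ S Z q))
    ... | inj₂ x∈Y = inj₂ (∩⁺ x∈Y (∩⁻ʳ S Z q))

∈-dec : ∀ {n} x (X : Subset n) → x ∈ X ⊎ x ∉ X
∈-dec x X with X x in eq
... | true = inj₁ ∈⟨ eq ⟩
... | false = inj₂ (false⇒∉ eq)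

∈pair⁻ : ∀ {n} {u v x : Fin n} → x ∈ ⁅ u ⁆ ∪ ⁅ v ⁆ → x ≡ u ⊎ x ≡ v
∈pair⁻ {u = u} {v} p with ∪⁻ ⁅ u ⁆ ⁅ v ⁆ p
... | inj₁ x∈⁅u⁆ = inj₁ (∈⁅⁆⇒≡ x∈⁅u⁆)
... | inj₂ x∈⁅v⁆ = inj₂ (∈⁅⁆⇒≡ x∈⁅v⁆)

pair-⊆ : ∀ {n} {X : Subset n} {x y} → x ∈ X → y ∈ X → ⁅ x ⁆ ∪ ⁅ y ⁆ ⊆ X
pair-⊆ {X = X} {x} {y} x∈X y∈X p with ∪⁻ ⁅ x ⁆ ⁅ y ⁆ p
... | inj₁ z∈⁅x⁆ = subst (_∈ X) (sym (∈⁅⁆⇒≡ z∈⁅x⁆)) x∈X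
... | inj₂ z∈⁅y⁆ = subst (_∈ X) (sym (∈⁅⁆⇒≡ z∈⁅y⁆)) y∈X

◃-mono : ∀ {n} {X Y : Subset n} t → X ⊆ Y → t ◃ X ⊆ t ◃ Y
◃-mono {X = X} {Y} t X⊆Y p with ◃⁻ X p
... | inj₁ refl = ◃-here t Y
... | inj₂ x∈X = ◃-there t (X⊆Y x∈X)

pair-partition : ∀ {n} {u v : Fin n} → ¬ u ≡ v → (⁅ u ⁆ ∪ ⁅ v ⁆) ≐ ⁅ u ⁆ ⊔ ⁅ v ⁆
pair-partition u≢v = ∪-partition λ y∈⁅u⁆ y∈⁅v⁆ → u≢v (trans (sym (∈⁅⁆⇒≡ y∈⁅u⁆)) (∈⁅⁆⇒≡ y∈⁅v⁆))

◃-─-partition : ∀ {n} {X Y : Subset n} {t} → X ⊆ Y → t ∉ Y → (t ◃ Y) ≐ (t ◃ X) ⊔ (Y ─ X)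
◃-─-partition {X = X} {Y} {t} X⊆Y t∉Y = record
  { ⊆ˡ = ◃-mono t X⊆Y
  ; ⊆ʳ = ◃-there t ∘ ─⁻ˡ Y X
  ; cover = cover
  ; disjoint = disjoint }
  where
  cover : ∀ {x} → x ∈ t ◃ Y → x ∈ t ◃ X ⊎ x ∈ Y ─ X
  cover p with ◃⁻ Y p
  ... | inj₁ refl = inj₁ (◃-here t X)
  ... | inj₂ x∈Y with ∈-dec _ X
  ...   | inj₁ x∈X = inj₁ (◃-there t x∈X)
  ...   | inj₂ x∉X = inj₂ (─⁺ x∈Y x∉X)
  disjoint : ∀ {x} → x ∈ t ◃ X → x ∈ Y ─ X → ⊥
  disjoint p q with ◃⁻ X p
  ... | inj₁ refl = t∉Y (─⁻ˡ Y X q)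
  ... | inj₂ x∈X = ─⁻ʳ Y X q x∈X

move-partition : ∀ {n} {T X Y C : Subset n} → T ≐ X ⊔ Y → C ⊆ X → T ≐ (X ─ C) ⊔ (Y ∪ C)
move-partition {T = T} {X} {Y} {C} part C⊆X = record
  { ⊆ˡ = ⊆ˡ ∘ ─⁻ˡ X C
  ; ⊆ʳ = ⊆ʳ′
  ; cover = cover′
  ; disjoint = disjoint′ }
  where
  open _≐_⊔_ part
  ⊆ʳ′ : Y ∪ C ⊆ T
  ⊆ʳ′ p with ∪⁻ Y C p
  ... | inj₁ x∈Y = ⊆ʳ x∈Y
  ... | inj₂ x∈C = ⊆ˡ (C⊆X x∈C)
  cover′ : ∀ {x} → x ∈ T → x ∈ X ─ C ⊎ x ∈ Y ∪ C
  cover′ {x} x∈T with cover x∈T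
  ... | inj₂ x∈Y = inj₂ (∪⁺ˡ C x∈Y)
  ... | inj₁ x∈X with ∈-dec x C
  ...   | inj₁ x∈C = inj₂ (∪⁺ʳ Y x∈C)
  ...   | inj₂ x∉C = inj₁ (─⁺ x∈X x∉C)
  disjoint′ : ∀ {x} → x ∈ X ─ C → x ∈ Y ∪ C → ⊥
  disjoint′ p q with ∪⁻ Y C q
  ... | inj₁ x∈Y = disjoint (─⁻ˡ X C p) x∈Y
  ... | inj₂ x∈C = ─⁻ʳ X C p x∈C

◃-partition₂ : ∀ {n} {S T Y₁ Y₂ : Subset n} {u v} → ¬ u ≡ v →
  S ≐ T ⊔ (⁅ u ⁆ ∪ ⁅ v ⁆) → T ≐ Y₁ ⊔ Y₂ → S ≐ (u ◃ Y₁) ⊔ (v ◃ Y₂)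
◃-partition₂ {S = S} {T} {Y₁} {Y₂} {u} {v} u≢v S-part T-part = record
  { ⊆ˡ = ⊆S u∈S (T.⊆ˡ) ; ⊆ʳ = ⊆S v∈S (T.⊆ʳ) ; cover = cover ; disjoint = disjoint }
  where
  module S = _≐_⊔_ S-part
  module T = _≐_⊔_ T-part
  u∈S = S.⊆ʳ (∪⁺ˡ ⁅ v ⁆ (∈⁅⁆ u))
  v∈S = S.⊆ʳ (∪⁺ʳ ⁅ u ⁆ (∈⁅⁆ v))
  ⊆S : ∀ {t Y} → t ∈ S → Y ⊆ T → t ◃ Y ⊆ S
  ⊆S {t} {Y} t∈S Y⊆T p with ◃⁻ Y p
  ... | inj₁ refl = t∈S
  ... | inj₂ x∈Y = S.⊆ˡ (Y⊆T x∈Y)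
  ∉T : ∀ {t} → t ≡ u ⊎ t ≡ v → t ∉ T
  ∉T (inj₁ refl) t∈T = S.disjoint t∈T (∪⁺ˡ ⁅ v ⁆ (∈⁅⁆ u))
  ∉T (inj₂ refl) t∈T = S.disjoint t∈T (∪⁺ʳ ⁅ u ⁆ (∈⁅⁆ v))
  cover : ∀ {x} → x ∈ S → x ∈ u ◃ Y₁ ⊎ x ∈ v ◃ Y₂
  cover x∈S with S.cover x∈S
  ... | inj₂ x∈B with ∈pair⁻ x∈B
  ...   | inj₁ refl = inj₁ (◃-here u Y₁)
  ...   | inj₂ refl = inj₂ (◃-here v Y₂)
  cover x∈S | inj₁ x∈T with T.cover x∈T
  ...   | inj₁ x∈Y₁ = inj₁ (◃-there u x∈Y₁)
  ...   | inj₂ x∈Y₂ = inj₂ (◃-there v x∈Y₂)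
  disjoint : ∀ {x} → x ∈ u ◃ Y₁ → x ∈ v ◃ Y₂ → ⊥
  disjoint p q with ◃⁻ Y₁ p | ◃⁻ Y₂ q
  ... | inj₁ refl | inj₁ x≡v = u≢v x≡v
  ... | inj₁ refl | inj₂ x∈Y₂ = ∉T (inj₁ refl) (T.⊆ʳ x∈Y₂)
  ... | inj₂ x∈Y₁ | inj₁ refl = ∉T (inj₂ refl) (T.⊆ˡ x∈Y₁)
  ... | inj₂ x∈Y₁ | inj₂ x∈Y₂ = T.disjoint x∈Y₁ x∈Y₂

anyᵇ : ∀ {n} → (Fin n → Bool) → Bool
anyᵇ {zero} f = false
anyᵇ {suc n} f = f zero ∨ anyᵇ (f ∘ suc)

anyᵇ⁺ : ∀ {n} (f : Fin n → Bool) i → f i ≡ true → anyᵇ f ≡ true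
anyᵇ⁺ f zero p rewrite p = refl
anyᵇ⁺ f (suc i) p rewrite anyᵇ⁺ (f ∘ suc) i p = ∨-zeroʳ (f zero)

anyᵇ⁻ : ∀ {n} (f : Fin n → Bool) → anyᵇ f ≡ true → Σ (Fin n) λ i → f i ≡ true
anyᵇ⁻ {suc n} f p with f zero in eq
... | true = zero , eq
... | false with anyᵇ⁻ (f ∘ suc) p
...   | i , q = suc i , q

⊆-or-new : ∀ {n} (X Y : Subset n) → X ⊆ Y ⊎ Σ (Fin n) λ y → y ∈ X × y ∉ Y
⊆-or-new X Y with anyᵇ (X ─ Y) in eq
... | true with anyᵇ⁻ (X ─ Y) eq
...   | y , p = inj₂ (y , ─⁻ˡ X Y ∈⟨ p ⟩ , ─⁻ʳ X Y ∈⟨ p ⟩)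
⊆-or-new X Y | false = inj₁ old
  where
  old : X ⊆ Y
  old {y} y∈X with Y y in eq′
  ... | true = ∈⟨ eq′ ⟩
  ... | false with () ← trans (sym (anyᵇ⁺ (X ─ Y) y (true-at (─⁺ {X = X} {Y} y∈X (false⇒∉ eq′))))) eq

∣_∣ : ∀ {n} → Subset n → ℕ
∣_∣ {zero} X = 0
∣_∣ {suc n} X = 𝟙 (X zero) + ∣ X ∘ suc ∣

sum-allFin≡∣∣ : ∀ {n} (X : Subset n) → sum (map (𝟙 ∘ X) (allFin n)) ≡ ∣ X ∣
sum-allFin≡∣∣ {n} X = trans (cong sum (map-tabulate id (𝟙 ∘ X))) (go X)
  where
  go : ∀ {m} (Y : Subset m) → sum (tabulate (𝟙 ∘ Y)) ≡ ∣ Y ∣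
  go {zero} Y = refl
  go {suc m} Y = cong (𝟙 (Y zero) +_) (go (Y ∘ suc))

𝟙-mono : ∀ {n} {X Y : Subset n} → X ⊆ Y → ∀ x → 𝟙 (X x) ≤ 𝟙 (Y x)
𝟙-mono {X = X} X⊆Y x with X x in eq
... | true rewrite true-at (X⊆Y ∈⟨ eq ⟩) = ≤-refl
... | false = z≤n

𝟙≤1 : ∀ b → 𝟙 b ≤ 1
𝟙≤1 true = ≤-refl
𝟙≤1 false = z≤n

∣∣-cong : ∀ {n} {X Y : Subset n} → (∀ x → X x ≡ Y x) → ∣ X ∣ ≡ ∣ Y ∣
∣∣-cong {zero} eq = refl
∣∣-cong {suc n} eq = cong₂ _+_ (cong 𝟙 (eq zero)) (∣∣-cong (eq ∘ suc))

∩-cong-on : ∀ {n} {X P Q : Subset n} → (∀ {x} → x ∈ X → P x ≡ Q x) → ∣ X ∩ P ∣ ≡ ∣ X ∩ Q ∣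
∩-cong-on {X = X} {P} {Q} eq = ∣∣-cong pointwise
  where
  pointwise : ∀ x → X x ∧ P x ≡ X x ∧ Q x
  pointwise x with X x in x∈X
  ... | true = eq ∈⟨ x∈X ⟩
  ... | false = refl

∣∣-+ : ∀ {n} {S X Y : Subset n} → (∀ x → 𝟙 (S x) ≡ 𝟙 (X x) + 𝟙 (Y x)) → ∣ S ∣ ≡ ∣ X ∣ + ∣ Y ∣
∣∣-+ {zero} eq = refl
∣∣-+ {suc n} {S} {X} {Y} eq = trans (cong₂ _+_ (eq zero) (∣∣-+ (eq ∘ suc)))
  (interchange (𝟙 (X zero)) (𝟙 (Y zero)) ∣ X ∘ suc ∣ ∣ Y ∘ suc ∣)

∣∣-+-≤ : ∀ {n} {S X Y : Subset n} → (∀ x → 𝟙 (S x) ≤ 𝟙 (X x) + 𝟙 (Y x)) → ∣ S ∣ ≤ ∣ X ∣ + ∣ Y ∣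
∣∣-+-≤ {zero} le = z≤n
∣∣-+-≤ {suc n} {S} {X} {Y} le = ≤-trans (+-mono-≤ (le zero) (∣∣-+-≤ (le ∘ suc)))
  (≤-reflexive (interchange (𝟙 (X zero)) (𝟙 (Y zero)) ∣ X ∘ suc ∣ ∣ Y ∘ suc ∣))

∣∣-∪ : ∀ {n} (X Y : Subset n) → ∣ X ∪ Y ∣ ≤ ∣ X ∣ + ∣ Y ∣
∣∣-∪ X Y = ∣∣-+-≤ λ x → 𝟙-∨ (X x) (Y x)
  where
  𝟙-∨ : ∀ a b → 𝟙 (a ∨ b) ≤ 𝟙 a + 𝟙 b
  𝟙-∨ true b = s≤s z≤n
  𝟙-∨ false b = ≤-refl

∣∣≤n : ∀ {n} (X : Subset n) → ∣ X ∣ ≤ n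
∣∣≤n {zero} X = z≤n
∣∣≤n {suc n} X = +-mono-≤ (𝟙≤1 (X zero)) (∣∣≤n (X ∘ suc))

∣∣-all : ∀ n → ∣ (λ (_ : Fin n) → true) ∣ ≡ n
∣∣-all zero = refl
∣∣-all (suc n) = cong suc (∣∣-all n)

∣∣-empty : ∀ {n} {X : Subset n} → (∀ x → x ∉ X) → ∣ X ∣ ≡ 0
∣∣-empty {zero} none = refl
∣∣-empty {suc n} {X} none rewrite ∉⇒false (none zero) =
  ∣∣-empty {X = X ∘ suc} λ x x∈X → none (suc x) ∈⟨ true-at x∈X ⟩

⊆-tail : ∀ {n} {X Y : Subset (suc n)} → X ⊆ Y → X ∘ suc ⊆ Y ∘ suc
⊆-tail X⊆Y ∈⟨ p ⟩ = ∈⟨ true-at (X⊆Y ∈⟨ p ⟩) ⟩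

∣∣-mono : ∀ {n} {X Y : Subset n} → X ⊆ Y → ∣ X ∣ ≤ ∣ Y ∣
∣∣-mono {zero} X⊆Y = z≤n
∣∣-mono {suc n} X⊆Y = +-mono-≤ (𝟙-mono X⊆Y zero) (∣∣-mono (⊆-tail X⊆Y))

∣∣-mono-< : ∀ {n} {X Y : Subset n} {y} → X ⊆ Y → y ∈ Y → y ∉ X → ∣ X ∣ < ∣ Y ∣
∣∣-mono-< {suc n} {X} {Y} {zero} X⊆Y y∈Y y∉X rewrite true-at y∈Y | ∉⇒false y∉X = s≤s (∣∣-mono (⊆-tail X⊆Y))
∣∣-mono-< {suc n} {X} {Y} {suc y} X⊆Y ∈⟨ y∈Y ⟩ y∉X =
  +-mono-≤-< (𝟙-mono X⊆Y zero) (∣∣-mono-< (⊆-tail X⊆Y) ∈⟨ y∈Y ⟩ λ p → y∉X ∈⟨ true-at p ⟩)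

∈⇒∣∣≥1 : ∀ {n} {X : Subset n} {x} → x ∈ X → 1 ≤ ∣ X ∣
∈⇒∣∣≥1 {suc n} {X} {zero} ∈⟨ x∈X ⟩ rewrite x∈X = s≤s z≤n
∈⇒∣∣≥1 {suc n} {X} {suc x} ∈⟨ x∈X ⟩ = ≤-trans (∈⇒∣∣≥1 {X = X ∘ suc} ∈⟨ x∈X ⟩) (m≤n+m _ (𝟙 (X zero)))

∣∣≥1⇒∈ : ∀ {n} {X : Subset n} → 1 ≤ ∣ X ∣ → Σ (Fin n) (_∈ X)
∣∣≥1⇒∈ {suc n} {X} le with X zero in eq
... | true = zero , ∈⟨ eq ⟩
... | false with ∣∣≥1⇒∈ le
...   | x , ∈⟨ x∈X ⟩ = suc x , ∈⟨ x∈X ⟩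

∣∣≡0⇒∉ : ∀ {n} {X : Subset n} {x} → ∣ X ∣ ≡ 0 → x ∉ X
∣∣≡0⇒∉ ∣X∣≡0 x∈X with () ← ≤-trans (∈⇒∣∣≥1 x∈X) (≤-reflexive ∣X∣≡0)

∣∣<n⇒∉ : ∀ {n} {X : Subset n} → ∣ X ∣ < n → Σ (Fin n) (_∉ X)
∣∣<n⇒∉ {suc n} {X} lt with X zero in eq
... | false = zero , false⇒∉ eq
... | true with ∣∣<n⇒∉ (≤-pred lt)
...   | x , x∉X = suc x , λ x∈X → x∉X ∈⟨ true-at x∈X ⟩

∣∣-singleton : ∀ {n} {X : Subset n} z → z ∈ X → (∀ y → y ∈ X → y ≡ z) → ∣ X ∣ ≡ 1
∣∣-singleton {suc n} {X} zero ∈⟨ z∈X ⟩ only rewrite z∈X =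
  cong suc (∣∣-empty λ y y∈X → 0≢1+n (sym (only (suc y) ∈⟨ true-at y∈X ⟩)))
∣∣-singleton {suc n} {X} (suc z) ∈⟨ z∈X ⟩ only with X zero in eq
... | true = ⊥-elim (0≢1+n (only zero ∈⟨ eq ⟩))
... | false = ∣∣-singleton {X = X ∘ suc} z ∈⟨ z∈X ⟩ λ y y∈X → suc-injective (only (suc y) ∈⟨ true-at y∈X ⟩)

∣⁅⁆∣ : ∀ {n} (x : Fin n) → ∣ ⁅ x ⁆ ∣ ≡ 1
∣⁅⁆∣ x = ∣∣-singleton x (∈⁅⁆ x) (λ y → ∈⁅⁆⇒≡)

∣∣-punchIn : ∀ {n} (X : Subset (suc n)) v → ∣ X ∣ ≡ 𝟙 (X v) + ∣ X ∘ punchIn v ∣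
∣∣-punchIn X zero = refl
∣∣-punchIn {suc n} X (suc v) =
  trans (cong (𝟙 (X zero) +_) (∣∣-punchIn (X ∘ suc) v))
        (x∙yz≈y∙xz (𝟙 (X zero)) (𝟙 (X (suc v))) ∣ X ∘ suc ∘ punchIn v ∣)

module _ {n : ℕ} {S X Y : Subset n} (p : S ≐ X ⊔ Y) where
  open _≐_⊔_ p

  ∣∣-partition : ∣ S ∣ ≡ ∣ X ∣ + ∣ Y ∣
  ∣∣-partition = ∣∣-+ pointwise
    where
    pointwise : ∀ x → 𝟙 (S x) ≡ 𝟙 (X x) + 𝟙 (Y x)
    pointwise x with S x in s | X x in a | Y x in b
    ... | _ | true | true = ⊥-elim (disjoint ∈⟨ a ⟩ ∈⟨ b ⟩)
    ... | true | true | false = refl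
    ... | true | false | true = refl
    ... | false | true | false = ⊥-elim (false⇒∉ s (⊆ˡ ∈⟨ a ⟩))
    ... | false | false | true = ⊥-elim (false⇒∉ s (⊆ʳ ∈⟨ b ⟩))
    ... | false | false | false = refl
    ... | true | false | false with cover ∈⟨ s ⟩
    ...   | inj₁ x∈X = ⊥-elim (false⇒∉ a x∈X)
    ...   | inj₂ x∈Y = ⊥-elim (false⇒∉ b x∈Y)

  same-parity : Even ∣ S ∣ → isOdd ∣ X ∣ ≡ isOdd ∣ Y ∣
  same-parity (even p)
    with isOdd ∣ X ∣ | isOdd ∣ Y ∣ | trans (sym (isOdd-+ ∣ X ∣ ∣ Y ∣)) (trans (cong isOdd (sym ∣∣-partition)) p)
  ... | true | true | _ = refl
  ... | false | false | _ = refl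

  even-partition : Even ∣ S ∣ → Even ∣ X ∣ → Even ∣ Y ∣
  even-partition S-even (even p) = even (trans (sym (same-parity S-even)) p)

  odd-partition : Even ∣ S ∣ → Odd ∣ X ∣ → Odd ∣ Y ∣
  odd-partition S-even (odd p) = odd (trans (sym (same-parity S-even)) p)

∣pair∣ : ∀ {n} {u v : Fin n} → ¬ u ≡ v → ∣ ⁅ u ⁆ ∪ ⁅ v ⁆ ∣ ≡ 2
∣pair∣ {u = u} {v} u≢v = trans (∣∣-partition (pair-partition u≢v)) (cong₂ _+_ (∣⁅⁆∣ u) (∣⁅⁆∣ v))

∣∣≤1⇒unique : ∀ {n} {X : Subset n} {x y} → ∣ X ∣ ≤ 1 → x ∈ X → y ∈ X → x ≡ y
∣∣≤1⇒unique {x = x} {y} ∣X∣≤1 x∈X y∈X with x ≟ y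
... | yes x≡y = x≡y
... | no x≢y with s≤s () ← ≤-trans (≤-reflexive (sym (∣pair∣ x≢y))) (≤-trans (∣∣-mono (pair-⊆ x∈X y∈X)) ∣X∣≤1)

isOdd-◃ : ∀ {n} {x} {X : Subset n} → x ∉ X → isOdd ∣ x ◃ X ∣ ≡ not (isOdd ∣ X ∣)
isOdd-◃ {x = x} {X} x∉X = cong isOdd (trans (∣∣-partition (◃-partition x∉X)) (cong (_+ ∣ X ∣) (∣⁅⁆∣ x)))

◃-even : ∀ {n} {x} {X : Subset n} → x ∉ X → Odd ∣ X ∣ → Even ∣ x ◃ X ∣
◃-even x∉X (odd p) = even (trans (isOdd-◃ x∉X) (cong not p))

◃-odd⁻ : ∀ {n} {x} {X : Subset n} → x ∉ X → Odd ∣ x ◃ X ∣ → Even ∣ X ∣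
◃-odd⁻ {X = X} x∉X (odd p) with isOdd ∣ X ∣ in eq
... | false = even eq
... | true with () ← trans (sym (trans (isOdd-◃ x∉X) (cong not eq))) p

image : ∀ {n k} → (Fin n → Fin k) → Subset n → Subset k
image c W β = anyᵇ (W ∩ λ y → c y == β)

∈image : ∀ {n k} {c : Fin n → Fin k} {W y} → y ∈ W → c y ∈ image c W
∈image {c = c} {W} {y} y∈W =
  ∈⟨ anyᵇ⁺ (W ∩ λ z → c z == c y) y (true-at (∩⁺ {Y = λ z → c z == c y} y∈W ∈⟨ ==-refl (c y) ⟩)) ⟩

∣image∣≤ : ∀ {n k} (c : Fin n → Fin k) (W : Subset n) → ∣ image c W ∣ ≤ ∣ W ∣
∣image∣≤ {zero} c W = ≤-reflexive (∣∣-empty {X = image c W} λ β → λ { ∈⟨ () ⟩ })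
∣image∣≤ {suc n} c W = ≤-trans (∣∣-∪ (λ β → W zero ∧ (c zero == β)) (image (c ∘ suc) (W ∘ suc)))
  (+-mono-≤ (head (W zero)) (∣image∣≤ (c ∘ suc) (W ∘ suc)))
  where
  head : ∀ b → ∣ (λ β → b ∧ (c zero == β)) ∣ ≤ 𝟙 b
  head true = ≤-reflexive (∣∣-singleton (c zero) ∈⟨ ==-refl (c zero) ⟩ λ β p → sym (==⇒≡ (true-at p)))
  head false = ≤-reflexive (∣∣-empty {X = λ β → false ∧ (c zero == β)} λ β → λ { ∈⟨ () ⟩ })

transpose-injective : ∀ {n} (i j : Fin n) → Injective _≡_ _≡_ (transpose i j)
transpose-injective i j {a} {b} p =
  trans (sym (transpose-inverse j i)) (trans (cong (transpose j i) p) (transpose-inverse j i))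

transpose-left : ∀ {n} (i j : Fin n) → transpose i j i ≡ j
transpose-left i j rewrite dec-true (i ≟ i) refl = refl

transpose-other : ∀ {n} {i j k : Fin n} → ¬ k ≡ i → ¬ k ≡ j → transpose i j k ≡ k
transpose-other {i = i} {j} {k} k≢i k≢j rewrite dec-false (k ≟ i) k≢i | dec-false (k ≟ j) k≢j = refl

Relabelling : ℕ → Set
Relabelling K = Σ (Fin K → Fin K) (Injective _≡_ _≡_)

relabel-one : ∀ {K} (i α : Fin K) → Σ (Relabelling K) λ (π , _) → π i ≡ α
relabel-one i α = (transpose i α , transpose-injective i α) , transpose-left i α

relabel-two : ∀ {K} {i j α β : Fin K} → ¬ i ≡ j → ¬ α ≡ β →
  Σ (Relabelling K) λ (π , _) → π i ≡ α × π j ≡ β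
relabel-two {i = i} {j} {α} {β} i≢j α≢β =
  (π , λ p → transpose-injective i α (transpose-injective j′ β p)) , πi≡α , transpose-left j′ β
  where
  j′ = transpose i α j
  π = transpose j′ β ∘ transpose i α
  πi≡α : π i ≡ α
  πi≡α rewrite transpose-left i α =
    transpose-other (λ α≡j′ → i≢j (transpose-injective i α (trans (transpose-left i α) α≡j′))) α≢β

avoid-preimage : ∀ {K} {A : Subset K} {π : Fin K → Fin K} {i α} →
  Injective _≡_ _≡_ π → π i ≡ α → i ∉ A → ∀ {γ} → γ ∈ A → ¬ π γ ≡ α
avoid-preimage {A = A} π-inj πi≡α i∉A γ∈A πγ≡α = i∉A (subst (_∈ A) (π-inj (trans πγ≡α (sym πi≡α))) γ∈A)

-- The preimages of α and β are chosen outside A and B respectively.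
relabel-avoiding : ∀ {K} (A B : Subset K) (α β : Fin K) → ∣ A ∣ + ∣ B ∣ < K →
  Σ (Relabelling K) λ (π , _) → (∀ {γ} → γ ∈ A → ¬ π γ ≡ α) × (∀ {γ} → γ ∈ B → ¬ π γ ≡ β)
relabel-avoiding A B α β small with α ≟ β
... | yes refl =
  let i , i∉A∪B = ∣∣<n⇒∉ (≤-trans (s≤s (∣∣-∪ A B)) small)
      (π , π-inj) , πi≡α = relabel-one i α
  in (π , π-inj) , avoid-preimage π-inj πi≡α (i∉A∪B ∘ ∪⁺ˡ B) , avoid-preimage π-inj πi≡α (i∉A∪B ∘ ∪⁺ʳ A)
... | no α≢β with ∣ B ∣ in ∣B∣≡
...   | zero =
  let i , i∉A = ∣∣<n⇒∉ (≤-trans (s≤s (m≤m+n ∣ A ∣ 0)) small)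
      (π , π-inj) , πi≡α = relabel-one i α
  in (π , π-inj) , avoid-preimage π-inj πi≡α i∉A , λ γ∈B _ → ∣∣≡0⇒∉ ∣B∣≡ γ∈B
...   | suc b =
  let j , j∉B = ∣∣<n⇒∉ {X = B} (≤-trans (s≤s (≤-trans (≤-reflexive ∣B∣≡) (m≤n+m (suc b) ∣ A ∣))) small)
      ∣A∪j∣≤ = ≤-trans (∣∣-∪ A ⁅ j ⁆) (+-monoʳ-≤ ∣ A ∣ (≤-trans (≤-reflexive (∣⁅⁆∣ j)) (s≤s z≤n)))
      i , i∉A∪j = ∣∣<n⇒∉ {X = A ∪ ⁅ j ⁆} (≤-trans (s≤s ∣A∪j∣≤) small)
      i≢j = λ i≡j → i∉A∪j (∪⁺ʳ A (subst (_∈ ⁅ j ⁆) (sym i≡j) (∈⁅⁆ j)))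
      (π , π-inj) , πi≡α , πj≡β = relabel-two i≢j α≢β
  in (π , π-inj) , avoid-preimage π-inj πi≡α (i∉A∪j ∘ ∪⁺ˡ ⁅ j ⁆) , avoid-preimage π-inj πj≡β j∉B

module Connectivity {N : ℕ} (G : Graph N) where

  infix 4 _~_

  record _~_ (x y : Fin N) : Set where
    constructor ~⟨_⟩
    field adjacent : adj G x y ≡ true
  open _~_ public

  ~-sym : ∀ {x y} → x ~ y → y ~ x
  ~-sym {x} {y} ~⟨ p ⟩ = ~⟨ trans (adj-sym G y x) p ⟩

  ~-irrefl : ∀ {x y} → x ~ y → x ≡ y → ⊥
  ~-irrefl {x} ~⟨ p ⟩ refl with () ← trans (sym p) (adj-irr G x)

  nbhd : Fin N → Subset N
  nbhd = adj G

  nbhd⁺ : ∀ {x y} → x ~ y → y ∈ nbhd x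
  nbhd⁺ ~⟨ p ⟩ = ∈⟨ p ⟩

  nbhd⁻ : ∀ {x y} → y ∈ nbhd x → x ~ y
  nbhd⁻ ∈⟨ p ⟩ = ~⟨ p ⟩

  ∩nbhd⁺ : ∀ {X x y} → y ∈ X → x ~ y → y ∈ X ∩ nbhd x
  ∩nbhd⁺ y∈X x~y = ∩⁺ y∈X (nbhd⁺ x~y)

  ∩nbhd⁻ : ∀ {X x y} → y ∈ X ∩ nbhd x → y ∈ X × x ~ y
  ∩nbhd⁻ {X} {x} p = ∩⁻ˡ X (nbhd x) p , nbhd⁻ (∩⁻ʳ X (nbhd x) p)

  deg[_] : Subset N → Fin N → ℕ
  deg[ X ] x = ∣ X ∩ nbhd x ∣

  deg≥1 : ∀ {X x y} → y ∈ X → x ~ y → 1 ≤ deg[ X ] x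
  deg≥1 y∈X x~y = ∈⇒∣∣≥1 (∩nbhd⁺ y∈X x~y)

  deg≥1⇒neighbour : ∀ {X x} → 1 ≤ deg[ X ] x → Σ (Fin N) λ y → y ∈ X × x ~ y
  deg≥1⇒neighbour le = let y , p = ∣∣≥1⇒∈ le in y , ∩nbhd⁻ p

  -- The first vertex of a walk in X need not lie in X.
  data Walk (X : Subset N) : Fin N → Fin N → Set where
    [] : ∀ {x} → Walk X x x
    step : ∀ {x y z} → x ~ y → y ∈ X → Walk X y z → Walk X x z

  walk-++ : ∀ {X x y z} → Walk X x y → Walk X y z → Walk X x z
  walk-++ [] q = q
  walk-++ (step a b p) q = step a b (walk-++ p q)

  walk-snoc : ∀ {X x y z} → Walk X x y → y ~ z → z ∈ X → Walk X x z
  walk-snoc p a b = walk-++ p (step a b [])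

  walk-end : ∀ {X x y} → x ∈ X → Walk X x y → y ∈ X
  walk-end x∈X [] = x∈X
  walk-end x∈X (step a b p) = walk-end b p

  walk-reverse : ∀ {X x y} → x ∈ X → Walk X x y → Walk X y x
  walk-reverse x∈X [] = []
  walk-reverse x∈X (step a b p) = walk-snoc (walk-reverse b p) (~-sym a) x∈X

  walk-mono : ∀ {X Y x y} → X ⊆ Y → Walk X x y → Walk Y x y
  walk-mono X⊆Y [] = []
  walk-mono X⊆Y (step a b p) = step a (X⊆Y b) (walk-mono X⊆Y p)

  ConnectedSet : Subset N → Set
  ConnectedSet X = ∀ {x y} → x ∈ X → y ∈ X → Walk X x y

  connected-via : ∀ {Z t} → t ∈ Z → (∀ {x} → x ∈ Z → Walk Z x t) → ConnectedSet Z
  connected-via t∈Z to-t x∈Z y∈Z = walk-++ (to-t x∈Z) (walk-reverse y∈Z (to-t y∈Z))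

  -- Y is a union of connected components of G[T].
  record Closed (T Y : Subset N) : Set where
    field
      ⊆T : Y ⊆ T
      closed : ∀ {x y} → x ∈ Y → y ∈ T → x ~ y → y ∈ Y
  open Closed public

  Closed-self : ∀ T → Closed T T
  Closed-self T = record { ⊆T = λ x∈T → x∈T ; closed = λ _ y∈T _ → y∈T }

  Closed-─ : ∀ {T Y Z} → Closed T Y → Closed T Z → Closed T (Y ─ Z)
  Closed-─ {T} {Y} {Z} clY clZ = record
    { ⊆T = λ p → ⊆T clY (─⁻ˡ Y Z p)
    ; closed = λ {x} {y} p y∈T x~y → ─⁺ (closed clY (─⁻ˡ Y Z p) y∈T x~y)
                 λ y∈Z → ─⁻ʳ Y Z p (closed clZ y∈Z (⊆T clY (─⁻ˡ Y Z p)) (~-sym x~y)) }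

  Closed-∪ : ∀ {T Y Z} → Closed T Y → Closed T Z → Closed T (Y ∪ Z)
  Closed-∪ {T} {Y} {Z} clY clZ = record { ⊆T = ⊆T′ ; closed = closed′ }
    where
    ⊆T′ : Y ∪ Z ⊆ T
    ⊆T′ p with ∪⁻ Y Z p
    ... | inj₁ x∈Y = ⊆T clY x∈Y
    ... | inj₂ x∈Z = ⊆T clZ x∈Z
    closed′ : ∀ {x y} → x ∈ Y ∪ Z → y ∈ T → x ~ y → y ∈ Y ∪ Z
    closed′ p y∈T x~y with ∪⁻ Y Z p
    ... | inj₁ x∈Y = ∪⁺ˡ Z (closed clY x∈Y y∈T x~y)
    ... | inj₂ x∈Z = ∪⁺ʳ Y (closed clZ x∈Z y∈T x~y)

  walk-closed : ∀ {T Y x y} → Closed T Y → x ∈ Y → Walk T x y → Walk Y x y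
  walk-closed cl x∈Y [] = []
  walk-closed cl x∈Y (step a b p) = let y∈Y = closed cl x∈Y b a in step a y∈Y (walk-closed cl y∈Y p)

  Attached : Subset N → Subset N → Fin N → Set
  Attached T Y t = ∀ {x} → x ∈ Y → Σ (Fin N) λ x′ → Walk T x x′ × x′ ~ t

  ◃-connected : ∀ {T Y t} → Closed T Y → Attached T Y t → ConnectedSet (t ◃ Y)
  ◃-connected {T} {Y} {t} cl att = connected-via (◃-here t Y) to-t
    where
    to-t : ∀ {x} → x ∈ t ◃ Y → Walk (t ◃ Y) x t
    to-t p with ◃⁻ Y p
    ... | inj₁ refl = []
    ... | inj₂ x∈Y with att x∈Y
    ...   | x′ , w , x′~t = walk-snoc (walk-mono (◃-there t) (walk-closed cl x∈Y w)) x′~t (◃-here t Y)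

  module Closure (T W : Subset N) where

    grow : Subset N → Subset N
    grow Y = Y ∪ T ∩ (λ y → anyᵇ (Y ∩ nbhd y))

    ⊆-grow : ∀ {Y} → Y ⊆ grow Y
    ⊆-grow {Y} = ∪⁺ˡ _

    grow⁺ : ∀ {Y y z} → y ∈ T → z ∈ Y → z ~ y → y ∈ grow Y
    grow⁺ {Y} {y} {z} y∈T z∈Y z~y = ∪⁺ʳ Y (∩⁺ y∈T ∈⟨ anyᵇ⁺ (Y ∩ nbhd y) z (true-at (∩nbhd⁺ z∈Y (~-sym z~y))) ⟩)

    grow⁻ : ∀ {Y y} → y ∈ grow Y → y ∈ Y ⊎ (y ∈ T × Σ (Fin N) λ z → z ∈ Y × z ~ y)
    grow⁻ {Y} {y} p with ∪⁻ Y _ p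
    ... | inj₁ y∈Y = inj₁ y∈Y
    ... | inj₂ q with anyᵇ⁻ (Y ∩ nbhd y) (true-at (∩⁻ʳ T _ q))
    ...   | z , r = let z∈Y , y~z = ∩nbhd⁻ ∈⟨ r ⟩ in inj₂ (∩⁻ˡ T _ q , z , z∈Y , ~-sym y~z)

    grow-mono : ∀ {Y Z} → Y ⊆ Z → grow Y ⊆ grow Z
    grow-mono Y⊆Z p with grow⁻ p
    ... | inj₁ y∈Y = ⊆-grow (Y⊆Z y∈Y)
    ... | inj₂ (y∈T , z , z∈Y , z~y) = grow⁺ y∈T (Y⊆Z z∈Y) z~y

    stage : ℕ → Subset N
    stage zero = T ∩ W
    stage (suc t) = grow (stage t)

    Stable : ℕ → Set
    Stable t = stage (suc t) ⊆ stage t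

    stable-suc : ∀ t → Stable t → Stable (suc t)
    stable-suc t st = grow-mono st

    strict-or-stable : ∀ t → Stable t ⊎ ∣ stage t ∣ < ∣ stage (suc t) ∣
    strict-or-stable t with ⊆-or-new (stage (suc t)) (stage t)
    ... | inj₁ st = inj₁ st
    ... | inj₂ (y , new , old) = inj₂ (∣∣-mono-< ⊆-grow new old)

    stable-or-large : ∀ t → Stable t ⊎ t ≤ ∣ stage t ∣
    stable-or-large zero = inj₂ z≤n
    stable-or-large (suc t) with stable-or-large t | strict-or-stable t
    ... | inj₁ st | _ = inj₁ (stable-suc t st)
    ... | inj₂ _ | inj₁ st = inj₁ (stable-suc t st)
    ... | inj₂ le | inj₂ lt = inj₂ (≤-trans (s≤s le) lt)

    closure : Subset N
    closure = stage (suc N)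

    -- Each unstable step adds a vertex, so the iteration is stable after N + 1 steps.
    closure-stable : grow closure ⊆ closure
    closure-stable with stable-or-large (suc N)
    ... | inj₁ st = st
    ... | inj₂ le = ⊥-elim (<⇒≱ le (∣∣≤n (stage (suc N))))

    seeds-⊆-stage : ∀ t → T ∩ W ⊆ stage t
    seeds-⊆-stage zero p = p
    seeds-⊆-stage (suc t) p = ⊆-grow (seeds-⊆-stage t p)

    stage-⊆T : ∀ t → stage t ⊆ T
    stage-⊆T zero p = ∩⁻ˡ T W p
    stage-⊆T (suc t) p with grow⁻ p
    ... | inj₁ y∈stage = stage-⊆T t y∈stage
    ... | inj₂ (y∈T , _) = y∈T

    stage-seed : ∀ t {y} → y ∈ stage t → Σ (Fin N) λ w → w ∈ T ∩ W × Walk T w y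
    stage-seed zero p = _ , p , []
    stage-seed (suc t) p with grow⁻ p
    ... | inj₁ y∈stage = stage-seed t y∈stage
    ... | inj₂ (y∈T , z , z∈stage , z~y) with stage-seed t z∈stage
    ...   | w , w∈T∩W , walk = w , w∈T∩W , walk-snoc walk z~y y∈T

    closure-closed : Closed T closure
    closure-closed = record
      { ⊆T = stage-⊆T (suc N)
      ; closed = λ x∈C y∈T x~y → closure-stable (grow⁺ y∈T x∈C x~y) }

    seed-∈closure : ∀ {w} → w ∈ T → w ∈ W → w ∈ closure
    seed-∈closure w∈T w∈W = seeds-⊆-stage (suc N) (∩⁺ w∈T w∈W)

    closure-seed : ∀ {y} → y ∈ closure → Σ (Fin N) λ w → w ∈ T ∩ W × Walk T w y
    closure-seed = stage-seed (suc N)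

  open Closure using (closure; closure-closed; seed-∈closure; closure-seed) public

  component : Subset N → Fin N → Subset N
  component T w = closure T ⁅ w ⁆

  ∈component : ∀ {T w} → w ∈ T → w ∈ component T w
  ∈component {T} {w} w∈T = seed-∈closure T ⁅ w ⁆ w∈T (∈⁅⁆ w)

  component-closed : ∀ T w → Closed T (component T w)
  component-closed T w = closure-closed T ⁅ w ⁆

  component-walk : ∀ {T w y} → w ∈ T → y ∈ component T w → Walk (component T w) w y
  component-walk {T} {w} w∈T y∈C with closure-seed T ⁅ w ⁆ y∈C
  ... | w′ , w′∈T∩⁅w⁆ , walk rewrite ∈⁅⁆⇒≡ (∩⁻ʳ T ⁅ w ⁆ w′∈T∩⁅w⁆) =
    walk-closed (component-closed T w) (∈component w∈T) walk

  component-connected : ∀ {T w} → w ∈ T → ConnectedSet (component T w)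
  component-connected {T} {w} w∈T =
    connected-via (∈component w∈T) λ y∈C → walk-reverse (∈component w∈T) (component-walk w∈T y∈C)

  component-⊆ : ∀ {T Y w} → Closed T Y → w ∈ Y → component T w ⊆ Y
  component-⊆ {T} cl w∈Y y∈C =
    walk-end w∈Y (walk-closed cl w∈Y (walk-mono (⊆T (component-closed T _)) (component-walk (⊆T cl w∈Y) y∈C)))

  component-attached : ∀ {T w t} → w ∈ T → w ~ t → Attached T (component T w) t
  component-attached {T} {w} w∈T w~t x∈C =
    w , walk-mono (⊆T (component-closed T w)) (walk-reverse (∈component w∈T) (component-walk w∈T x∈C)) , w~t

  reach⇒walk : ∀ {x y} → Reach G x y → Walk (λ _ → true) x y
  reach⇒walk here = []
  reach⇒walk (step x~y r) = step ~⟨ x~y ⟩ ∈⟨ refl ⟩ (reach⇒walk r)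

induced : ∀ {n m} → Graph n → (Fin m → Fin n) → Graph m
induced G e = record
  { adj = λ i j → adj G (e i) (e j)
  ; adj-sym = λ i j → adj-sym G (e i) (e j)
  ; adj-irr = λ i → adj-irr G (e i) }

record InducedIn (H : GraphClass) {n} (G : Graph n) (S : Subset n) : Set where
  field
    m : ℕ
    emb : Fin m → Fin n
    emb-injective : ∀ {i j} → emb i ≡ emb j → i ≡ j
    emb-∈ : ∀ i → emb i ∈ S
    emb-onto : ∀ {x} → x ∈ S → Σ (Fin m) λ i → emb i ≡ x
    count : ∀ (P : Subset n) → ∣ P ∘ emb ∣ ≡ ∣ S ∩ P ∣
    induced-∈H : H m (induced G emb)

module _ (H : GraphClass)
  (H-iso : ∀ n (G G′ : Graph n) → Isomorphic G G′ → H n G → H n G′)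
  (H-delete : ∀ m (G : Graph (suc m)) (v : Fin (suc m)) → H (suc m) G → H m (deleteVertex G v))
  where

  induced-whole : ∀ {n} (G : Graph n) {S} → H n G → (∀ x → x ∈ S) → InducedIn H G S
  induced-whole {n} G {S} G∈H all∈S = record
    { m = n ; emb = id ; emb-injective = id ; emb-∈ = all∈S ; emb-onto = λ {x} _ → x , refl
    ; count = λ P → ∣∣-cong λ x → cong (_∧ P x) (sym (true-at (all∈S x)))
    ; induced-∈H = H-iso n G (induced G id) (↔-id (Fin n) , λ _ _ → refl) G∈H }

  induced-delete : ∀ {n} (G : Graph (suc n)) {S} v → v ∉ S →
    InducedIn H (deleteVertex G v) (S ∘ punchIn v) → InducedIn H G S
  induced-delete G {S} v v∉S I = record
    { m = m
    ; emb = punchIn v ∘ emb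
    ; emb-injective = λ p → emb-injective (punchIn-injective v _ _ p)
    ; emb-∈ = λ i → ∈⟨ true-at (emb-∈ i) ⟩
    ; emb-onto = onto
    ; count = λ P → trans (count (P ∘ punchIn v))
                      (sym (trans (∣∣-punchIn (S ∩ P) v) (cong (_+ ∣ (S ∩ P) ∘ punchIn v ∣) (𝟙-v P))))
    ; induced-∈H = induced-∈H }
    where
    open InducedIn I
    𝟙-v : ∀ P → 𝟙 ((S ∩ P) v) ≡ 0
    𝟙-v P rewrite ∉⇒false v∉S = refl
    onto : ∀ {x} → x ∈ S → Σ (Fin m) λ i → punchIn v (emb i) ≡ x
    onto {x} x∈S with v ≟ x
    ... | yes refl = ⊥-elim (v∉S x∈S)
    ... | no v≢x with emb-onto {punchOut v≢x} ∈⟨ trans (cong S (punchIn-punchOut v≢x)) (true-at x∈S) ⟩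
    ...   | i , p = i , trans (cong (punchIn v) p) (punchIn-punchOut v≢x)

  induced-subset : ∀ {n} (G : Graph n) → H n G → ∀ S → InducedIn H G S
  induced-subset {n} G G∈H S with ⊆-or-new (λ _ → true) S
  ... | inj₁ all⊆S = induced-whole G G∈H λ x → all⊆S ∈⟨ refl ⟩
  induced-subset {suc n} G G∈H S | inj₂ (v , _ , v∉S) =
    induced-delete G v v∉S (induced-subset (deleteVertex G v) (H-delete n G v G∈H) (S ∘ punchIn v))

module OddColourings {N : ℕ} (G : Graph N) (K : ℕ) where
  open Connectivity G

  Colouring : Set
  Colouring = Fin N → Fin K

  coloured : Colouring → Fin K → Subset N
  coloured c α y = c y == α

  colDeg : Subset N → Colouring → Fin K → Fin N → ℕ
  colDeg X c α x = ∣ X ∩ nbhd x ∩ coloured c α ∣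

  sameDeg : Subset N → Colouring → Fin N → ℕ
  sameDeg X c x = colDeg X c (c x) x

  OddOn : Subset N → Colouring → Set
  OddOn X c = ∀ {x} → x ∈ X → Odd (sameDeg X c x)

  OddColourable : Subset N → Set
  OddColourable X = Σ Colouring (OddOn X)

  OddColourableExcept : Subset N → Fin N → Set
  OddColourableExcept X t =
    Σ Colouring λ c → (∀ {x} → x ∈ X → ¬ x ≡ t → Odd (sameDeg X c x)) × Even (sameDeg X c t)

  oddOn-all⇒IsOddColouring : ∀ {c} → OddOn (λ _ → true) c → IsOddColouring G K c
  oddOn-all⇒IsOddColouring {c} odd-c v = trans (cong (_% 2) degIn≡sameDeg) (odd⇒%2≡1 (odd-c ∈⟨ refl ⟩))
    where
    degIn≡sameDeg : degIn G (λ y → c y == c v) v ≡ sameDeg (λ _ → true) c v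
    degIn≡sameDeg = trans (cong sum (map-cong pointwise (allFin N))) (sum-allFin≡∣∣ (nbhd v ∩ coloured c (c v)))
      where
      pointwise : ∀ y → (if adj G v y then 𝟙 (c y == c v) else 0) ≡ 𝟙 ((nbhd v ∩ coloured c (c v)) y)
      pointwise y with adj G v y
      ... | true = refl
      ... | false = refl

  deg-partition : ∀ {S X Y} → S ≐ X ⊔ Y → ∀ x → deg[ S ] x ≡ deg[ X ] x + deg[ Y ] x
  deg-partition p x = ∣∣-partition (∩-partition (nbhd x) p)

  colDeg-partition : ∀ {S X Y} → S ≐ X ⊔ Y → ∀ c α x → colDeg S c α x ≡ colDeg X c α x + colDeg Y c α x
  colDeg-partition p c α x = ∣∣-partition (∩-partition (nbhd x ∩ coloured c α) p)

  colDeg-cong : ∀ {X c c′ α x} → (∀ {y} → y ∈ X → c y ≡ c′ y) → colDeg X c α x ≡ colDeg X c′ α x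
  colDeg-cong {X} {α = α} {x} eq = ∩-cong-on {X = X} λ {y} y∈X → cong (λ β → adj G x y ∧ (β == α)) (eq y∈X)

  colDeg-relabel : ∀ {X c α x} {π : Fin K → Fin K} → Injective _≡_ _≡_ π →
    colDeg X (π ∘ c) (π α) x ≡ colDeg X c α x
  colDeg-relabel {X} {c} {α} {x} π-inj = ∩-cong-on {X = X} λ {y} _ → cong (adj G x y ∧_) (==-injective π-inj (c y) α)

  colDeg-none : ∀ {X c α x} → (∀ {y} → y ∈ X → x ~ y → ¬ c y ≡ α) → colDeg X c α x ≡ 0
  colDeg-none {X} {c} {α} {x} none = ∣∣-empty λ y p →
    none (∩⁻ˡ X _ p) (nbhd⁻ (∩⁻ˡ (nbhd x) _ (∩⁻ʳ X _ p)))
      (==⇒≡ (true-at (∩⁻ʳ (nbhd x) (coloured c α) (∩⁻ʳ X _ p))))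

  colDeg-one : ∀ {X c α x z} → z ∈ X → x ~ z → c z ≡ α → (∀ {y} → y ∈ X → x ~ y → y ≡ z) → colDeg X c α x ≡ 1
  colDeg-one {X} {c} {α} {x} {z} z∈X x~z cz≡α only = ∣∣-singleton z
    (∩⁺ z∈X (∩⁺ (nbhd⁺ x~z) ∈⟨ subst (λ β → (c z == β) ≡ true) cz≡α (==-refl (c z)) ⟩))
    λ y p → only (∩⁻ˡ X _ p) (nbhd⁻ (∩⁻ˡ (nbhd x) _ (∩⁻ʳ X _ p)))

  odd⇒deg≥1 : ∀ {X x} c → OddOn X c → x ∈ X → 1 ≤ deg[ X ] x
  odd⇒deg≥1 {X} {x} c odd-c x∈X =
    ≤-trans (pos (odd-c x∈X)) (∣∣-mono λ p → ∩⁺ (∩⁻ˡ X _ p) (∩⁻ˡ (nbhd x) _ (∩⁻ʳ X _ p)))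
    where
    pos : ∀ {n} → Odd n → 1 ≤ n
    pos {zero} (odd ())
    pos {suc n} _ = s≤s z≤n

  fresh-colour : ∀ (c : Colouring) W → ∣ W ∣ < K → Σ (Fin K) λ β → ∀ {y} → y ∈ W → ¬ c y ≡ β
  fresh-colour c W small with ∣∣<n⇒∉ (≤-trans (s≤s (∣image∣≤ c W)) small)
  ... | β , β∉image = β , λ y∈W cy≡β → β∉image (subst (_∈ image c W) cy≡β (∈image y∈W))

  module Merge {S X Y : Subset N} (part : S ≐ X ⊔ Y) (cX cY : Colouring)
               {π : Fin K → Fin K} (π-inj : Injective _≡_ _≡_ π) where
    open _≐_⊔_ part

    merged : Colouring
    merged y = if X y then cX y else π (cY y)

    merged-X : ∀ {y} → y ∈ X → merged y ≡ cX y
    merged-X ∈⟨ y∈X ⟩ rewrite y∈X = refl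

    merged-Y : ∀ {y} → y ∈ Y → merged y ≡ π (cY y)
    merged-Y {y} y∈Y rewrite ∉⇒false {X = X} λ y∈X → disjoint y∈X y∈Y = refl

    sameDeg-mergedˡ : ∀ {x} → x ∈ X → sameDeg S merged x ≡ sameDeg X cX x + colDeg Y (π ∘ cY) (cX x) x
    sameDeg-mergedˡ {x} x∈X rewrite merged-X x∈X =
      trans (colDeg-partition part merged (cX x) x) (cong₂ _+_ (colDeg-cong merged-X) (colDeg-cong merged-Y))

    sameDeg-mergedʳ : ∀ {y} → y ∈ Y → sameDeg S merged y ≡ sameDeg Y cY y + colDeg X cX (π (cY y)) y
    sameDeg-mergedʳ {y} y∈Y rewrite merged-Y y∈Y = begin
      colDeg S merged (π (cY y)) y
        ≡⟨ colDeg-partition part merged (π (cY y)) y ⟩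
      colDeg X merged (π (cY y)) y + colDeg Y merged (π (cY y)) y
        ≡⟨ +-comm (colDeg X merged (π (cY y)) y) _ ⟩
      colDeg Y merged (π (cY y)) y + colDeg X merged (π (cY y)) y
        ≡⟨ cong₂ _+_ (colDeg-cong merged-Y) (colDeg-cong merged-X) ⟩
      colDeg Y (π ∘ cY) (π (cY y)) y + colDeg X cX (π (cY y)) y
        ≡⟨ cong (_+ colDeg X cX (π (cY y)) y) (colDeg-relabel {Y} {cY} {cY y} {y} π-inj) ⟩
      sameDeg Y cY y + colDeg X cX (π (cY y)) y
        ∎
      where open ≡-Reasoning

    merged-odd : OddOn X cX → OddOn Y cY →
      (∀ {x y} → x ∈ X → y ∈ Y → x ~ y → ¬ cX x ≡ π (cY y)) → OddOn S merged
    merged-odd oddX oddY bichromatic x∈S with cover x∈S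
    ... | inj₁ x∈X = subst Odd (sym (trans (sameDeg-mergedˡ x∈X) (cong (_ +_) cross≡0))) (odd+0 (oddX x∈X))
      where
      cross≡0 = colDeg-none λ y∈Y x~y eq → bichromatic x∈X y∈Y x~y (sym eq)
    ... | inj₂ x∈Y = subst Odd (sym (trans (sameDeg-mergedʳ x∈Y) (cong (_ +_) cross≡0))) (odd+0 (oddY x∈Y))
      where
      cross≡0 = colDeg-none λ y∈X x~y eq → bichromatic y∈X x∈Y (~-sym x~y) eq


  colDeg-⁅⁆ : ∀ {P c α x w} → w ∈ P → (∀ {y} → y ∈ P → x ~ y → y ≡ w) → colDeg P c α x ≡ colDeg ⁅ w ⁆ c α x
  colDeg-⁅⁆ {P} {c} {α} {x} {w} w∈P only = ∣∣-cong pointwise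
    where
    pointwise : ∀ y → (P ∩ nbhd x ∩ coloured c α) y ≡ (⁅ w ⁆ ∩ nbhd x ∩ coloured c α) y
    pointwise y with y ≟ w
    ... | yes refl rewrite true-at w∈P = refl
    ... | no y≢w with P y in y∈P | adj G x y in x~y
    ...   | true | true = ⊥-elim (y≢w (only ∈⟨ y∈P ⟩ ~⟨ x~y ⟩))
    ...   | true | false = refl
    ...   | false | _ = refl

  edge-bounds : ∀ {S U V u v cU cV} → S ≐ U ⊔ V → u ∈ U → v ∈ V → u ~ v → OddOn U cU → OddOn V cV →
    deg[ S ] u + deg[ S ] v ≤ suc K → deg[ U ] v < K × deg[ V ] u < K
  edge-bounds {S} {U} {V} {u} {v} {cU} {cV} part u∈U v∈V u~v oddU oddV bound =
    drop-positive-ends (deg≥1 (⊆ʳ v∈V) u~v) (odd⇒deg≥1 cV oddV v∈V)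
      (subst (_≤ suc K) (trans (cong (deg[ S ] u +_) (deg-partition part v))
                               (sym (+-assoc (deg[ S ] u) (deg[ U ] v) (deg[ V ] v)))) bound) ,
    drop-positive-ends (odd⇒deg≥1 cU oddU u∈U) (deg≥1 (⊆ˡ u∈U) (~-sym u~v))
      (subst (λ d → d + deg[ S ] v ≤ suc K) (deg-partition part u) bound)
    where open _≐_⊔_ part

  -- The colour of v is sent to a colour missing around v in U, and a colour missing around u in V
  -- is sent to the colour of u.
  glue-across-edge : ∀ {S U V u v} → S ≐ U ⊔ V → u ∈ U → v ∈ V → u ~ v →
    (∀ {x y} → x ∈ U → y ∈ V → x ~ y → x ≡ u ⊎ y ≡ v) →
    deg[ S ] u + deg[ S ] v ≤ suc K → OddColourable U → OddColourable V → OddColourable S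
  glue-across-edge {S} {U} {V} {u} {v} part u∈U v∈V u~v cross bound (cU , oddU) (cV , oddV)
    with edge-bounds part u∈U v∈V u~v oddU oddV bound
  ... | deg[U]v<K , deg[V]u<K
    with fresh-colour cU (U ∩ nbhd v) deg[U]v<K | fresh-colour cV (V ∩ nbhd u) deg[V]u<K
  ... | β , avoid-β | γ , avoid-γ
    with relabel-two {i = cV v} {γ} {β} {cU u}
           (avoid-γ (∩nbhd⁺ v∈V u~v)) (λ β≡cUu → avoid-β (∩nbhd⁺ u∈U (~-sym u~v)) (sym β≡cUu))
  ... | (π , π-inj) , πcVv≡β , πγ≡cUu = merged , merged-odd oddU oddV bichromatic
    where
    open Merge part cU cV π-inj
    bichromatic : ∀ {x y} → x ∈ U → y ∈ V → x ~ y → ¬ cU x ≡ π (cV y)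
    bichromatic {x} {y} x∈U y∈V x~y eq with cross x∈U y∈V x~y
    ... | inj₁ refl = avoid-γ (∩nbhd⁺ y∈V x~y) (π-inj (trans (sym eq) (sym πγ≡cUu)))
    ... | inj₂ refl = avoid-β (∩nbhd⁺ x∈U (~-sym x~y)) (trans eq πcVv≡β)

  glue-hanging : ∀ {S R C u v} → S ≐ R ⊔ C → u ∈ R → v ∈ R → u ~ v →
    (∀ {x y} → x ∈ R → y ∈ C → x ~ y → x ≡ u ⊎ x ≡ v) →
    deg[ S ] u + deg[ S ] v ≤ suc K → OddColourable R → OddColourable C → OddColourable S
  glue-hanging {S} {R} {C} {u} {v} part u∈R v∈R u~v cross bound (cR , oddR) (cC , oddC)
    with relabel-avoiding (image cC (C ∩ nbhd u)) (image cC (C ∩ nbhd v)) (cR u) (cR v) few-colours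
    where
    few-colours : ∣ image cC (C ∩ nbhd u) ∣ + ∣ image cC (C ∩ nbhd v) ∣ < K
    few-colours = ≤-trans (s≤s (+-mono-≤ (∣image∣≤ cC (C ∩ nbhd u)) (∣image∣≤ cC (C ∩ nbhd v))))
      (drop-positive-heads (deg≥1 v∈R u~v) (deg≥1 u∈R (~-sym u~v))
        (subst₂ (λ du dv → du + dv ≤ suc K) (deg-partition part u) (deg-partition part v) bound))
  ... | (π , π-inj) , avoid-u , avoid-v = merged , merged-odd oddR oddC bichromatic
    where
    open Merge part cR cC π-inj
    bichromatic : ∀ {x y} → x ∈ R → y ∈ C → x ~ y → ¬ cR x ≡ π (cC y)
    bichromatic x∈R y∈C x~y eq with cross x∈R y∈C x~y
    ... | inj₁ refl = avoid-u (∈image (∩nbhd⁺ y∈C x~y)) (sym eq)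
    ... | inj₂ refl = avoid-v (∈image (∩nbhd⁺ y∈C x~y)) (sym eq)

  glue-bridge : ∀ {S U V u v} → S ≐ U ⊔ V → u ∈ U → v ∈ V → u ~ v →
    (∀ {x y} → x ∈ U → y ∈ V → x ~ y → x ≡ u × y ≡ v) →
    OddColourableExcept U u → OddColourableExcept V v → OddColourable S
  glue-bridge {S} {U} {V} {u} {v} part u∈U v∈V u~v cross (cU , oddU , evenU) (cV , oddV , evenV)
    with relabel-one (cV v) (cU u)
  ... | (π , π-inj) , πcVv≡cUu = merged , odd-S
    where
    open _≐_⊔_ part
    open Merge part cU cV π-inj
    odd-S : OddOn S merged
    odd-S {x} x∈S with cover x∈S | x ≟ u | x ≟ v
    ... | inj₁ x∈U | yes refl | _ = subst Odd (sym (trans (sameDeg-mergedˡ x∈U) (cong (sameDeg U cU u +_)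
            (colDeg-one v∈V u~v πcVv≡cUu λ y∈V u~y → proj₂ (cross u∈U y∈V u~y))))) (even+1 evenU)
    ... | inj₁ x∈U | no x≢u | _ = subst Odd (sym (trans (sameDeg-mergedˡ x∈U) (cong (sameDeg U cU x +_)
            (colDeg-none λ y∈V x~y _ → x≢u (proj₁ (cross x∈U y∈V x~y)))))) (odd+0 (oddU x∈U x≢u))
    ... | inj₂ x∈V | _ | yes refl = subst Odd (sym (trans (sameDeg-mergedʳ x∈V) (cong (sameDeg V cV v +_)
            (colDeg-one u∈U (~-sym u~v) (sym πcVv≡cUu) λ y∈U v~y → proj₁ (cross y∈U v∈V (~-sym v~y)))))) (even+1 evenV)
    ... | inj₂ x∈V | _ | no x≢v = subst Odd (sym (trans (sameDeg-mergedʳ x∈V) (cong (sameDeg V cV x +_)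
            (colDeg-none λ y∈U x~y _ → x≢v (proj₂ (cross y∈U x∈V (~-sym x~y))))))) (odd+0 (oddV x∈V x≢v))

  colDeg-⁅self⁆ : ∀ {c α w} → colDeg ⁅ w ⁆ c α w ≡ 0
  colDeg-⁅self⁆ = colDeg-none λ y∈⁅w⁆ w~y _ → ~-irrefl w~y (sym (∈⁅⁆⇒≡ y∈⁅w⁆))

  glue-at-vertex : ∀ {Z P Y w} → Z ≐ P ⊔ Y → w ∈ P →
    (∀ {x y} → x ∈ P → y ∈ Y → x ~ y → x ≡ w) →
    OddColourable P → OddColourable (w ◃ Y) → OddColourableExcept Z w
  glue-at-vertex {Z} {P} {Y} {w} part w∈P cross (cP , oddP) (cQ , oddQ) with relabel-one (cQ w) (cP w)
  ... | (π , π-inj) , πcQw≡cPw = merged , odd-off-w , even-at-w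
    where
    open _≐_⊔_ part
    open Merge part cP cQ π-inj
    open ≡-Reasoning

    sameDeg-◃ : ∀ y → sameDeg (w ◃ Y) cQ y ≡ colDeg ⁅ w ⁆ cQ (cQ y) y + sameDeg Y cQ y
    sameDeg-◃ y = colDeg-partition (◃-partition (disjoint w∈P)) cQ (cQ y) y

    even-at-w : Even (sameDeg Z merged w)
    even-at-w = subst Even (sym at-w) (odd+odd (oddP w∈P) (oddQ (◃-here w Y)))
      where
      at-w : sameDeg Z merged w ≡ sameDeg P cP w + sameDeg (w ◃ Y) cQ w
      at-w = begin
        sameDeg Z merged w
          ≡⟨ sameDeg-mergedˡ w∈P ⟩
        sameDeg P cP w + colDeg Y (π ∘ cQ) (cP w) w
          ≡⟨ cong (λ α → sameDeg P cP w + colDeg Y (π ∘ cQ) α w) (sym πcQw≡cPw) ⟩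
        sameDeg P cP w + colDeg Y (π ∘ cQ) (π (cQ w)) w
          ≡⟨ cong (sameDeg P cP w +_) (colDeg-relabel {Y} {cQ} {cQ w} {w} π-inj) ⟩
        sameDeg P cP w + sameDeg Y cQ w
          ≡⟨ cong (λ d → sameDeg P cP w + (d + sameDeg Y cQ w)) (sym (colDeg-⁅self⁆ {cQ})) ⟩
        sameDeg P cP w + (colDeg ⁅ w ⁆ cQ (cQ w) w + sameDeg Y cQ w)
          ≡⟨ cong (sameDeg P cP w +_) (sym (sameDeg-◃ w)) ⟩
        sameDeg P cP w + sameDeg (w ◃ Y) cQ w
          ∎

    odd-off-w : ∀ {x} → x ∈ Z → ¬ x ≡ w → Odd (sameDeg Z merged x)
    odd-off-w {x} x∈Z x≢w with cover x∈Z
    ... | inj₁ x∈P = subst Odd (sym (trans (sameDeg-mergedˡ x∈P) (cong (sameDeg P cP x +_)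
            (colDeg-none λ y∈Y x~y _ → x≢w (cross x∈P y∈Y x~y))))) (odd+0 (oddP x∈P))
    ... | inj₂ x∈Y = subst Odd (sym at-x) (oddQ (◃-there w x∈Y))
      where
      cP≡πcQ-on-w : ∀ {y} → y ∈ ⁅ w ⁆ → cP y ≡ π (cQ y)
      cP≡πcQ-on-w y∈⁅w⁆ rewrite ∈⁅⁆⇒≡ y∈⁅w⁆ = sym πcQw≡cPw
      at-x : sameDeg Z merged x ≡ sameDeg (w ◃ Y) cQ x
      at-x = begin
        sameDeg Z merged x
          ≡⟨ sameDeg-mergedʳ x∈Y ⟩
        sameDeg Y cQ x + colDeg P cP (π (cQ x)) x
          ≡⟨ cong (sameDeg Y cQ x +_) (colDeg-⁅⁆ w∈P λ y∈P x~y → cross y∈P x∈Y (~-sym x~y)) ⟩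
        sameDeg Y cQ x + colDeg ⁅ w ⁆ cP (π (cQ x)) x
          ≡⟨ cong (sameDeg Y cQ x +_) (colDeg-cong cP≡πcQ-on-w) ⟩
        sameDeg Y cQ x + colDeg ⁅ w ⁆ (π ∘ cQ) (π (cQ x)) x
          ≡⟨ cong (sameDeg Y cQ x +_) (colDeg-relabel {⁅ w ⁆} {cQ} {cQ x} {x} π-inj) ⟩
        sameDeg Y cQ x + colDeg ⁅ w ⁆ cQ (cQ x) x
          ≡⟨ +-comm (sameDeg Y cQ x) _ ⟩
        colDeg ⁅ w ⁆ cQ (cQ x) x + sameDeg Y cQ x
          ≡⟨ sym (sameDeg-◃ x) ⟩
        sameDeg (w ◃ Y) cQ x
          ∎

  attach-pendants : ∀ {S R B w} → S ≐ R ⊔ B → w ∈ R → Even ∣ B ∣ → (∀ {z} → z ∈ B → z ~ w) →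
    (∀ {z y} → z ∈ B → y ∈ S → z ~ y → y ≡ w) → OddColourable R → OddColourable S
  attach-pendants {S} {R} {B} {w} part w∈R B-even B~w only-w (cR , oddR) = merged , odd-S
    where
    open _≐_⊔_ part
    open Merge part cR (λ _ → cR w) {λ γ → γ} (λ eq → eq)

    all-B-at-w : colDeg B (λ _ → cR w) (cR w) w ≡ ∣ B ∣
    all-B-at-w = ∣∣-cong pointwise
      where
      pointwise : ∀ z → (B ∩ nbhd w ∩ coloured (λ _ → cR w) (cR w)) z ≡ B z
      pointwise z with B z in z∈B
      ... | false = refl
      ... | true rewrite adjacent (~-sym (B~w ∈⟨ z∈B ⟩)) = ==-refl (cR w)

    odd-S : OddOn S merged
    odd-S {x} x∈S with cover x∈S | x ≟ w
    ... | inj₁ x∈R | yes refl = subst Odd (sym (trans (sameDeg-mergedˡ x∈R) (cong (sameDeg R cR w +_) all-B-at-w)))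
            (odd+even (oddR x∈R) B-even)
    ... | inj₁ x∈R | no x≢w = subst Odd (sym (trans (sameDeg-mergedˡ x∈R) (cong (sameDeg R cR x +_)
            (colDeg-none λ y∈B x~y _ → x≢w (only-w y∈B x∈S (~-sym x~y)))))) (odd+0 (oddR x∈R))
    ... | inj₂ x∈B | _ = subst Odd (sym (trans (sameDeg-mergedʳ x∈B) (cong₂ _+_
            (colDeg-none λ y∈B x~y _ → disjoint w∈R (subst (_∈ B) (only-w x∈B (⊆ʳ y∈B) x~y) y∈B))
            (colDeg-one w∈R (B~w x∈B) refl λ y∈R x~y → only-w x∈B (⊆ˡ y∈R) x~y)))) (odd refl)

TwinsOrLightEdge : ∀ {n} → Graph n → ℕ → Set
TwinsOrLightEdge {n} G k =
    (Σ (Fin n) λ u → Σ (Fin n) λ v → ¬ (u ≡ v) × pendant G u × pendant G v × SameNbhd G u v)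
  ⊎ (Σ (Fin n) λ u → Σ (Fin n) λ v → (adj G u v ≡ true) × (deg G u + deg G v ≤ k))

module Induction (H : GraphClass)
  (H-iso : ∀ n (G G′ : Graph n) → Isomorphic G G′ → H n G → H n G′)
  (H-delete : ∀ m (G : Graph (suc m)) (v : Fin (suc m)) → H (suc m) G → H m (deleteVertex G v))
  (K′ : ℕ)
  (twins-or-light : ∀ n (G : Graph n) → H n G → Connected G → 2 ≤ n → TwinsOrLightEdge G (suc (suc K′)))
  {N : ℕ} (G : Graph N) (G∈H : H N G)
  where

  K : ℕ
  K = suc K′

  open Connectivity G
  open OddColourings G K

  record Twins (S : Subset N) : Set where
    field
      {u v} : Fin N
      u∈S : u ∈ S
      v∈S : v ∈ S
      u≢v : ¬ u ≡ v
      deg-u≡1 : deg[ S ] u ≡ 1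
      same-nbhd : ∀ {y} → y ∈ S → adj G u y ≡ adj G v y

  record LightEdge (S : Subset N) : Set where
    field
      {u v} : Fin N
      u∈S : u ∈ S
      v∈S : v ∈ S
      u~v : u ~ v
      light : deg[ S ] u + deg[ S ] v ≤ suc K

  module _ (S : Subset N) where
    open InducedIn (induced-subset H H-iso H-delete G G∈H S)

    private
      G[S] = induced G emb

      m≡∣S∣ : m ≡ ∣ S ∣
      m≡∣S∣ = trans (sym (∣∣-all m)) (trans (count (λ _ → true)) (∣∣-cong λ x → ∧-identityʳ (S x)))

      deg-emb : ∀ i → deg G[S] i ≡ deg[ S ] (emb i)
      deg-emb i = trans (sum-allFin≡∣∣ (nbhd (emb i) ∘ emb)) (count (nbhd (emb i)))

      reach : ∀ {x y} → Walk S x y → ∀ {i j} → emb i ≡ x → emb j ≡ y → Reach G[S] i j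
      reach [] ei≡x ej≡x = subst (Reach G[S] _) (emb-injective (trans ei≡x (sym ej≡x))) here
      reach (step x~y y∈S walk) ei≡x ej≡z with emb-onto y∈S
      ... | k , ek≡y = step (trans (cong₂ (adj G) ei≡x ek≡y) (adjacent x~y)) (reach walk ek≡y ej≡z)

    twins-or-light-edge : ConnectedSet S → 2 ≤ ∣ S ∣ → Twins S ⊎ LightEdge S
    twins-or-light-edge S-conn 2≤∣S∣ with twins-or-light m G[S] induced-∈H G[S]-connected 2≤m
      where
      2≤m = subst (2 ≤_) (sym m≡∣S∣) 2≤∣S∣
      G[S]-connected : Connected G[S]
      G[S]-connected = ≤-trans (s≤s z≤n) 2≤m , λ i j → reach (S-conn (emb-∈ i) (emb-∈ j)) refl refl
    ... | inj₁ (u , v , u≢v , pendant-u , _ , same) = inj₁ record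
      { u∈S = emb-∈ u ; v∈S = emb-∈ v
      ; u≢v = u≢v ∘ emb-injective
      ; deg-u≡1 = trans (sym (deg-emb u)) pendant-u
      ; same-nbhd = λ y∈S → let k , ek≡y = emb-onto y∈S in
                    subst (λ y → adj G (emb u) y ≡ adj G (emb v) y) ek≡y (same k) }
    ... | inj₂ (u , v , u~v , light) = inj₂ record
      { u∈S = emb-∈ u ; v∈S = emb-∈ v ; u~v = ~⟨ u~v ⟩
      ; light = subst₂ (λ du dv → du + dv ≤ suc K) (deg-emb u) (deg-emb v) light }

  Smaller : Subset N → Set
  Smaller S = ∀ X → ∣ X ∣ < ∣ S ∣ → ConnectedSet X → Even ∣ X ∣ → OddColourable X

  module Step {S : Subset N} (smaller : Smaller S) (S-conn : ConnectedSet S) (S-even : Even ∣ S ∣) where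

    module TwinsCase (twins : Twins S) where
      open Twins twins

      B R : Subset N
      B = ⁅ u ⁆ ∪ ⁅ v ⁆
      R = S ─ B

      R-part : S ≐ R ⊔ B
      R-part = ─-partition (pair-⊆ u∈S v∈S)

      u-neighbour : Σ (Fin N) λ w → w ∈ S × u ~ w
      u-neighbour = deg≥1⇒neighbour (≤-reflexive (sym deg-u≡1))

      w : Fin N
      w = proj₁ u-neighbour

      w∈S : w ∈ S
      w∈S = proj₁ (proj₂ u-neighbour)

      u~w : u ~ w
      u~w = proj₂ (proj₂ u-neighbour)

      u-pendant : ∀ {y} → y ∈ S → u ~ y → y ≡ w
      u-pendant y∈S u~y = ∣∣≤1⇒unique (≤-reflexive deg-u≡1) (∩nbhd⁺ y∈S u~y) (∩nbhd⁺ w∈S u~w)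

      B~w : ∀ {z} → z ∈ B → z ~ w
      B~w z∈B with ∈pair⁻ z∈B
      ... | inj₁ refl = u~w
      ... | inj₂ refl = ~⟨ trans (sym (same-nbhd w∈S)) (adjacent u~w) ⟩

      only-w : ∀ {z y} → z ∈ B → y ∈ S → z ~ y → y ≡ w
      only-w z∈B y∈S z~y with ∈pair⁻ z∈B
      ... | inj₁ refl = u-pendant y∈S z~y
      ... | inj₂ refl = u-pendant y∈S ~⟨ trans (same-nbhd y∈S) (adjacent z~y) ⟩

      w∈R : w ∈ R
      w∈R = ─⁺ w∈S λ w∈B → ~-irrefl (B~w w∈B) refl

      walk-to-w : ∀ {x z} → Walk S x z → z ≡ w → x ∈ R → Walk R x w
      walk-to-w [] refl _ = []
      walk-to-w {x} (step x~y y∈S walk) z≡w x∈R with x ≟ w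
      ... | yes refl = []
      ... | no x≢w = step x~y y∈R (walk-to-w walk z≡w y∈R)
        where y∈R = ─⁺ y∈S λ y∈B → x≢w (only-w y∈B (─⁻ˡ S B x∈R) (~-sym x~y))

      R-conn : ConnectedSet R
      R-conn = connected-via w∈R λ x∈R → walk-to-w (S-conn (─⁻ˡ S B x∈R) w∈S) refl x∈R

      B-even : Even ∣ B ∣
      B-even = even (cong isOdd (∣pair∣ u≢v))

      R<S : ∣ R ∣ < ∣ S ∣
      R<S = ∣∣-mono-< (─⁻ˡ S B) u∈S λ u∈R → ─⁻ʳ S B u∈R (∪⁺ˡ ⁅ v ⁆ (∈⁅⁆ u))

      result : OddColourable S
      result = attach-pendants R-part w∈R B-even B~w only-w
        (smaller R R<S R-conn (even-partition (⊔-swap R-part) S-even B-even))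

    module LightEdgeCase (edge : LightEdge S) where
      open LightEdge edge

      u≢v : ¬ u ≡ v
      u≢v = ~-irrefl u~v

      T : Subset N
      T = S ─ (⁅ u ⁆ ∪ ⁅ v ⁆)

      T-part : S ≐ T ⊔ (⁅ u ⁆ ∪ ⁅ v ⁆)
      T-part = ─-partition (pair-⊆ u∈S v∈S)

      T⊆S : T ⊆ S
      T⊆S = ─⁻ˡ S _

      u∉T : u ∉ T
      u∉T u∈T = ─⁻ʳ S _ u∈T (∪⁺ˡ ⁅ v ⁆ (∈⁅⁆ u))

      v∉T : v ∉ T
      v∉T v∈T = ─⁻ʳ S _ v∈T (∪⁺ʳ ⁅ u ⁆ (∈⁅⁆ v))

      outside-T : ∀ {x} → x ∈ S → x ∉ T → x ≡ u ⊎ x ≡ v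
      outside-T x∈S x∉T with _≐_⊔_.cover T-part x∈S
      ... | inj₁ x∈T = ⊥-elim (x∉T x∈T)
      ... | inj₂ x∈B = ∈pair⁻ x∈B

      exit : ∀ {x} → x ∈ T → Σ (Fin N) λ x′ → Walk T x x′ × (x′ ~ u ⊎ x′ ~ v)
      exit x∈T = go (S-conn (T⊆S x∈T) u∈S) u∉T x∈T
        where
        go : ∀ {x z} → Walk S x z → z ∉ T → x ∈ T → Σ (Fin N) λ x′ → Walk T x x′ × (x′ ~ u ⊎ x′ ~ v)
        go [] z∉T z∈T = ⊥-elim (z∉T z∈T)
        go {x} (step {y = y} x~y y∈S walk) z∉T x∈T with ∈-dec y T
        ... | inj₁ y∈T = let x′ , walk′ , x′~uv = go walk z∉T y∈T in x′ , step x~y y∈T walk′ , x′~uv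
        ... | inj₂ y∉T with outside-T y∈S y∉T
        ...   | inj₁ refl = x , [] , inj₁ x~y
        ...   | inj₂ refl = x , [] , inj₂ x~y

      ◃<S : ∀ {t o Y} → t ∈ S → o ∈ S → o ∉ T → ¬ o ≡ t → Y ⊆ T → ∣ t ◃ Y ∣ < ∣ S ∣
      ◃<S {t} {o} {Y} t∈S o∈S o∉T o≢t Y⊆T = ∣∣-mono-< ◃⊆S o∈S o∉t◃Y
        where
        ◃⊆S : t ◃ Y ⊆ S
        ◃⊆S p with ◃⁻ Y p
        ... | inj₁ refl = t∈S
        ... | inj₂ x∈Y = T⊆S (Y⊆T x∈Y)
        o∉t◃Y : o ∉ t ◃ Y
        o∉t◃Y p with ◃⁻ Y p
        ... | inj₁ o≡t = o≢t o≡t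
        ... | inj₂ o∈Y = o∉T (Y⊆T o∈Y)

      two-sides : ∀ {Y₁ Y₂} → Closed T Y₁ → Closed T Y₂ → T ≐ Y₁ ⊔ Y₂ →
        Attached T Y₁ u → Attached T Y₂ v → Even ∣ u ◃ Y₁ ∣ → OddColourable S
      two-sides {Y₁} {Y₂} cl₁ cl₂ T-split att₁ att₂ U-even =
        glue-across-edge S-split (◃-here u Y₁) (◃-here v Y₂) u~v cross light
          (smaller (u ◃ Y₁) (◃<S u∈S v∈S v∉T (u≢v ∘ sym) (⊆T cl₁)) (◃-connected cl₁ att₁) U-even)
          (smaller (v ◃ Y₂) (◃<S v∈S u∈S u∉T u≢v (⊆T cl₂)) (◃-connected cl₂ att₂)
            (even-partition S-split S-even U-even))
        where
        S-split : S ≐ (u ◃ Y₁) ⊔ (v ◃ Y₂)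
        S-split = ◃-partition₂ u≢v T-part T-split
        cross : ∀ {x y} → x ∈ u ◃ Y₁ → y ∈ v ◃ Y₂ → x ~ y → x ≡ u ⊎ y ≡ v
        cross p q x~y with ◃⁻ Y₁ p | ◃⁻ Y₂ q
        ... | inj₁ x≡u | _ = inj₁ x≡u
        ... | inj₂ _ | inj₁ y≡v = inj₂ y≡v
        ... | inj₂ x∈Y₁ | inj₂ y∈Y₂ = ⊥-elim (_≐_⊔_.disjoint T-split (closed cl₁ x∈Y₁ (⊆T cl₂ y∈Y₂) x~y) y∈Y₂)

      even-component : ∀ {w} → w ∈ T → Even ∣ component T w ∣ → OddColourable S
      even-component {w} w∈T C-even =
        glue-hanging part (out-C u∈S u∉T) (out-C v∈S v∉T) u~v cross light
          (smaller R (∣∣-mono-< (─⁻ˡ S C) (T⊆S w∈T) λ w∈R → ─⁻ʳ S C w∈R (∈component w∈T)) R-conn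
            (even-partition (⊔-swap part) S-even C-even))
          (smaller C (∣∣-mono-< (T⊆S ∘ ⊆T C-closed) u∈S (u∉T ∘ ⊆T C-closed)) (component-connected w∈T) C-even)
        where
        C = component T w
        R = S ─ C
        C-closed = component-closed T w
        part : S ≐ R ⊔ C
        part = ─-partition (T⊆S ∘ ⊆T C-closed)
        out-C : ∀ {t} → t ∈ S → t ∉ T → t ∈ R
        out-C t∈S t∉T = ─⁺ t∈S (t∉T ∘ ⊆T C-closed)
        cross : ∀ {x y} → x ∈ R → y ∈ C → x ~ y → x ≡ u ⊎ x ≡ v
        cross {x} x∈R y∈C x~y with ∈-dec x T
        ... | inj₁ x∈T = ⊥-elim (─⁻ʳ S C x∈R (closed C-closed y∈C x∈T (~-sym x~y)))
        ... | inj₂ x∉T = outside-T (─⁻ˡ S C x∈R) x∉T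
        walk-in-R : ∀ {x y} → x ∈ T → x ∈ R → Walk T x y → Walk R x y
        walk-in-R x∈T x∈R walk = walk-mono (λ p → ─⁺ (T⊆S (─⁻ˡ T C p)) (─⁻ʳ T C p))
          (walk-closed (Closed-─ (Closed-self T) C-closed) (─⁺ x∈T (─⁻ʳ S C x∈R)) walk)
        to-u : ∀ {x} → x ∈ R → Walk R x u
        to-u {x} x∈R with ∈-dec x T
        ... | inj₂ x∉T with outside-T (─⁻ˡ S C x∈R) x∉T
        ...   | inj₁ refl = []
        ...   | inj₂ refl = step (~-sym u~v) (out-C u∈S u∉T) []
        to-u {x} x∈R | inj₁ x∈T with exit x∈T
        ... | x′ , walk , inj₁ x′~u = walk-snoc (walk-in-R x∈T x∈R walk) x′~u (out-C u∈S u∉T)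
        ... | x′ , walk , inj₂ x′~v =
          walk-snoc (walk-snoc (walk-in-R x∈T x∈R walk) x′~v (out-C v∈S v∉T)) (~-sym u~v) (out-C u∈S u∉T)
        R-conn : ConnectedSet R
        R-conn = connected-via (out-C u∈S u∉T) to-u

      AllComponentsOdd : Set
      AllComponentsOdd = ∀ {w} → w ∈ T → Odd ∣ component T w ∣

      attached-nonempty : ∀ {Y t y} → Closed T Y → Attached T Y t → y ∈ Y → 1 ≤ deg[ Y ] t
      attached-nonempty clY attY y∈Y with attY y∈Y
      ... | x′ , walk , x′~t = deg≥1 (walk-end y∈Y (walk-closed clY y∈Y walk)) (~-sym x′~t)

      -- Split off the component C₁ of a neighbour of t: t ◃ C₁ and t ◃ (Y ─ C₁) are both even,
      -- and gluing their odd colourings at t leaves t with an even number of like neighbours.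
      side-colouring : ∀ {t Y} → t ∉ T → Closed T Y → Attached T Y t → AllComponentsOdd →
        Odd ∣ t ◃ Y ∣ → ∣ t ◃ Y ∣ < ∣ S ∣ → OddColourableExcept (t ◃ Y) t
      side-colouring {t} {Y} t∉T clY attY all-odd Z-odd Z<S with deg[ Y ] t in deg≡
      ... | zero = (λ _ → zero) , (λ p x≢t → ⊥-elim (x≢t (only-t p))) ,
          subst Even (sym (colDeg-none {c = λ _ → zero} {α = zero} λ p t~y _ → ~-irrefl t~y (sym (only-t p))))
            (even refl)
        where
        only-t : ∀ {x} → x ∈ t ◃ Y → x ≡ t
        only-t p with ◃⁻ Y p
        ... | inj₁ x≡t = x≡t
        ... | inj₂ x∈Y with () ← ≤-trans (attached-nonempty clY attY x∈Y) (≤-reflexive deg≡)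
      ... | suc _ = glue-at-vertex Z-part (◃-here t C₁) cross
          (smaller (t ◃ C₁) (≤-trans (s≤s (∣∣-mono (◃-mono t C₁⊆Y))) Z<S) (◃-connected C₁-closed C₁-att)
            (◃-even (t∉T ∘ ⊆T C₁-closed) (all-odd w₁∈T)))
          (smaller (t ◃ (Y ─ C₁)) (≤-trans (s≤s (∣∣-mono (◃-mono t (─⁻ˡ Y C₁)))) Z<S)
            (◃-connected Y′-closed (attY ∘ ─⁻ˡ Y C₁))
            (◃-even (t∉T ∘ ⊆T clY ∘ ─⁻ˡ Y C₁) Y′-odd))
        where
        neighbour = deg≥1⇒neighbour {Y} (≤-trans (s≤s z≤n) (≤-reflexive (sym deg≡)))
        w₁ = proj₁ neighbour
        w₁∈Y = proj₁ (proj₂ neighbour)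
        w₁∈T = ⊆T clY w₁∈Y
        C₁ = component T w₁
        C₁-closed = component-closed T w₁
        C₁⊆Y = component-⊆ clY w₁∈Y
        C₁-att = component-attached w₁∈T (~-sym (proj₂ (proj₂ neighbour)))
        Y′-closed = Closed-─ clY C₁-closed
        Y′-odd : Odd ∣ Y ─ C₁ ∣
        Y′-odd = odd-partition (⊔-swap (─-partition C₁⊆Y)) (◃-odd⁻ (t∉T ∘ ⊆T clY) Z-odd) (all-odd w₁∈T)
        Z-part : (t ◃ Y) ≐ (t ◃ C₁) ⊔ (Y ─ C₁)
        Z-part = ◃-─-partition C₁⊆Y (t∉T ∘ ⊆T clY)
        cross : ∀ {x y} → x ∈ t ◃ C₁ → y ∈ Y ─ C₁ → x ~ y → x ≡ t
        cross p q x~y with ◃⁻ C₁ p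
        ... | inj₁ x≡t = x≡t
        ... | inj₂ x∈C₁ = ⊥-elim (─⁻ʳ Y C₁ q (closed C₁-closed x∈C₁ (⊆T clY (─⁻ˡ Y C₁ q)) x~y))

      -- X is the union of the components of T attached to u.  If u ◃ X is odd but some of these
      -- components is also attached to v, it is moved to v's side; if none is, uv is a bridge.
      module OddComponents (all-odd : AllComponentsOdd) where
        X Xᶜ : Subset N
        X = closure T (nbhd u)
        Xᶜ = T ─ X

        X-closed : Closed T X
        X-closed = closure-closed T (nbhd u)

        Xᶜ-closed : Closed T Xᶜ
        Xᶜ-closed = Closed-─ (Closed-self T) X-closed

        T-split : T ≐ X ⊔ Xᶜ
        T-split = ⊔-swap (─-partition (⊆T X-closed))

        u-nbr⇒X : ∀ {y} → y ∈ T → u ~ y → y ∈ X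
        u-nbr⇒X y∈T u~y = seed-∈closure T (nbhd u) y∈T (nbhd⁺ u~y)

        X-att : Attached T X u
        X-att x∈X with closure-seed T (nbhd u) x∈X
        ... | w , w∈T∩Nu , walk = let w∈T , u~w = ∩nbhd⁻ w∈T∩Nu in w , walk-reverse w∈T walk , ~-sym u~w

        Xᶜ-att : Attached T Xᶜ v
        Xᶜ-att x∈Xᶜ with exit (─⁻ˡ T X x∈Xᶜ)
        ... | x′ , walk , inj₂ x′~v = x′ , walk , x′~v
        ... | x′ , walk , inj₁ x′~u = ⊥-elim (─⁻ʳ T X x′∈Xᶜ (u-nbr⇒X (─⁻ˡ T X x′∈Xᶜ) (~-sym x′~u)))
          where x′∈Xᶜ = walk-end x∈Xᶜ (walk-closed Xᶜ-closed x∈Xᶜ walk)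

        move-component : ∀ {z} → z ∈ X → v ~ z → Odd ∣ u ◃ X ∣ → OddColourable S
        move-component {z} z∈X v~z U-odd =
          two-sides (Closed-─ X-closed C₀-closed) (Closed-∪ Xᶜ-closed C₀-closed) (move-partition T-split C₀⊆X)
            (X-att ∘ ─⁻ˡ X C₀) att₂ (◃-even (u∉T ∘ ⊆T X-closed ∘ ─⁻ˡ X C₀) Y₁-odd)
          where
          z∈T = ⊆T X-closed z∈X
          C₀ = component T z
          C₀-closed = component-closed T z
          C₀⊆X = component-⊆ X-closed z∈X
          att₂ : Attached T (Xᶜ ∪ C₀) v
          att₂ p with ∪⁻ Xᶜ C₀ p
          ... | inj₁ x∈Xᶜ = Xᶜ-att x∈Xᶜ
          ... | inj₂ x∈C₀ = component-attached z∈T (~-sym v~z) x∈C₀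
          Y₁-odd : Odd ∣ X ─ C₀ ∣
          Y₁-odd = odd-partition (⊔-swap (─-partition C₀⊆X)) (◃-odd⁻ (u∉T ∘ ⊆T X-closed) U-odd) (all-odd z∈T)

        bridge : deg[ X ] v ≡ 0 → Odd ∣ u ◃ X ∣ → OddColourable S
        bridge deg≡0 U-odd = glue-bridge S-split (◃-here u X) (◃-here v Xᶜ) u~v cross
          (side-colouring u∉T X-closed X-att all-odd U-odd (◃<S u∈S v∈S v∉T (u≢v ∘ sym) (⊆T X-closed)))
          (side-colouring v∉T Xᶜ-closed Xᶜ-att all-odd (odd-partition S-split S-even U-odd)
            (◃<S v∈S u∈S u∉T u≢v (⊆T Xᶜ-closed)))
          where
          S-split : S ≐ (u ◃ X) ⊔ (v ◃ Xᶜ)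
          S-split = ◃-partition₂ u≢v T-part T-split
          cross : ∀ {x y} → x ∈ u ◃ X → y ∈ v ◃ Xᶜ → x ~ y → x ≡ u × y ≡ v
          cross p q x~y with ◃⁻ X p | ◃⁻ Xᶜ q
          ... | inj₁ refl | inj₁ refl = refl , refl
          ... | inj₁ refl | inj₂ y∈Xᶜ = ⊥-elim (─⁻ʳ T X y∈Xᶜ (u-nbr⇒X (─⁻ˡ T X y∈Xᶜ) x~y))
          ... | inj₂ x∈X | inj₁ refl with () ← ≤-trans (deg≥1 x∈X (~-sym x~y)) (≤-reflexive deg≡0)
          ... | inj₂ x∈X | inj₂ y∈Xᶜ = ⊥-elim (─⁻ʳ T X y∈Xᶜ (closed X-closed x∈X (─⁻ˡ T X y∈Xᶜ) x~y))

        result : OddColourable S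
        result with isOdd ∣ u ◃ X ∣ in parity
        ... | false = two-sides X-closed Xᶜ-closed T-split X-att Xᶜ-att (even parity)
        ... | true with deg[ X ] v in deg≡
        ...   | zero = bridge deg≡ (odd parity)
        ...   | suc _ with deg≥1⇒neighbour {X} (≤-trans (s≤s z≤n) (≤-reflexive (sym deg≡)))
        ...     | z , z∈X , v~z = move-component z∈X v~z (odd parity)

      result : OddColourable S
      result with ⊆-or-new T (λ w → isOdd ∣ component T w ∣)
      ... | inj₁ all-odd = OddComponents.result λ w∈T → odd (true-at (all-odd w∈T))
      ... | inj₂ (w , w∈T , not-odd) = even-component w∈T (even (∉⇒false not-odd))

    result : 2 ≤ ∣ S ∣ → OddColourable S
    result 2≤∣S∣ with twins-or-light-edge S S-conn 2≤∣S∣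
    ... | inj₁ twins = TwinsCase.result twins
    ... | inj₂ edge = LightEdgeCase.result edge

  odd-colourable : ∀ S → ConnectedSet S → Even ∣ S ∣ → OddColourable S
  odd-colourable = All.wfRec (On.wellFounded ∣_∣ <-wellFounded) _
    (λ S → ConnectedSet S → Even ∣ S ∣ → OddColourable S) λ S smaller S-conn S-even →
    case even⇒0⊎≥2 S-even of λ where
      (inj₁ ∣S∣≡0) → (λ _ → zero) , λ {x} x∈S → ⊥-elim (∣∣≡0⇒∉ ∣S∣≡0 x∈S)
      (inj₂ 2≤∣S∣) → Step.result {S} (λ X → smaller) S-conn S-even 2≤∣S∣

theorem5 : (H : GraphClass) →
    (∀ n (G G' : Graph n) → Isomorphic G G' → H n G → H n G') →
    H 2 K2 →
    (∀ m (G : Graph (suc m)) (v : Fin (suc m)) → H (suc m) G → H m (deleteVertex G v)) →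
    (k : ℕ) → 2 ≤ k →
    (∀ n (G : Graph n) → H n G → Connected G → 2 ≤ n →
        (Σ (Fin n) λ u → Σ (Fin n) λ v →
            ¬ (u ≡ v) × pendant G u × pendant G v × SameNbhd G u v)
      ⊎ (Σ (Fin n) λ u → Σ (Fin n) λ v →
            (adj G u v ≡ true) × (deg G u + deg G v ≤ k))) →
    ∀ n (G : Graph n) → H n G → Connected G → n % 2 ≡ 0 →
    χodd≤ G (k ∸ 1)
theorem5 H H-iso _ H-delete (suc (suc K′)) (s≤s (s≤s z≤n)) twins-or-light n G G∈H (_ , G-conn) n-even =
  map₂ oddOn-all⇒IsOddColouring
    (odd-colourable (λ _ → true) (λ {x} {y} _ _ → reach⇒walk (G-conn x y)) whole-even)
  where
  open Connectivity G
  open OddColourings G (suc K′)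
  open Induction H H-iso H-delete K′ twins-or-light G G∈H
  whole-even : Even ∣ (λ (_ : Fin n) → true) ∣
  whole-even = subst Even (sym (∣∣-all n)) (%2≡0⇒even n n-even)
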